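{- Let $P$ be a program and let $B$ be a set of pattern rules that is correct w.r.t. $P$. Suppose that $\mathit{patunf}(P,B)$ contains a special pattern rule $r=(p,q)$, with witnesses as in the definition of special pattern rules below and associated $k$ and $\alpha(r)$. Then for all $n\in\mathbb N$ with $n\ge\alpha(r)$ and all $\theta\in S(\Sigma,X)$ there exists $\eta\in S(\Sigma,X)$ such that $p(n+k)\eta\in\mathit{calls}_P(p(n)\theta)$.
   Context: Fix a signature $\Sigma$, a special constant $\mathsf{e}$ (also denoting the empty sequence), hole constants $\square_1,\square_2,\dots$ and an infinite countable set $X$ of variables, pairwise disjoint. $T(\Sigma,X)$ is the set of terms, $S(\Sigma,X)$ the set of substitutions; composition $x(\sigma\theta)=(x\sigma)\theta$, $\emptyset$ identity, $\sigma^0=\emptyset$, $\sigma^{n+1}=\sigma^n\sigma$, $\mathsf{e}\theta=\mathsf{e}$; $\sigma$ commutes with $\theta$ if $x\sigma\theta=x\theta\sigma$ for all $x$. Renamings are bijective substitutions on $X$; $\mathit{mgu}$ denotes most general unifiers (componentwise on sequences). An $m$-context is a term over $\Sigma\cup\{\square_i\}$ and $X$ containing $\square_1,\dots,\square_m$ and no other hole; $c(s_1,\dots,s_m)$ replaces each $\square_i$ by $s_i$; for a 1-context $c$, $c^0=\square_1$, $c^{n+1}=c(c^n)$; $\chi^{(1)}$ is the set of 1-contexts without variables. A program is a set of rules $(u,\bar v)$, $\bar v$ a finite sequence $\langle\dots\rangle$ of terms; binary rules are written $(u,v)$, $v\in T(\Sigma,X)\cup\{\mathsf{e}\}$. $[r]$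 is the set of renamings of $r$, $[U]=\bigcup_{r\in U}[r]$; $\bar r\ll_S U$ means a sequence of elements of $U$ variable disjoint from $S$ and from each other. $\Rightarrow_r=\{(\langle s\rangle\bar s,(\bar v\bar s)\theta)\mid\langle(u,\bar v)\rangle\ll_{\langle s\rangle\bar s}[r],\theta\in\mathit{mgu}(u,s)\}$, $\Rightarrow_P=\bigcup_{r\in P}\Rightarrow_r$; $\mathit{calls}_P(s)=\{t\mid\langle s\rangle\Rightarrow_P^+\langle t,\dots\rangle\}\cup\{\mathsf{e}\mid\langle s\rangle\Rightarrow_P^+\mathsf{e}\}$. $\mathit{id}$ is the set of rules $(\mathsf{f}(x_1..x_m),\mathsf{f}(x_1..x_m))$ with distinct $x_i$. $T_P^\beta(U)=[\{(u,\mathsf{e})\in P\}]\cup[\{(u\theta,v\theta)\mid r=(u,\langle v_1..v_m\rangle)\in P,\ 1\le i\le m,\ \langle(u_1,\mathsf{e}),\dots,(u_{i-1},\mathsf{e}),(u_i,v)\rangle\ll_r U\cup\mathit{id},\ v\ne\mathsf{e}\text{ if }i<m,\ \theta\in\mathit{mgu}(\langle u_1..u_i\rangle,\langle v_1..v_i\rangle)\}]$; $\mathit{binunf}(P)=\bigcup_n(T_P^\beta)^n(\emptyset)$. A pattern substitution is $(\sigma,\mu)$ with $(\sigma,\mu)(n)=\sigma^n\mu$; a pattern term is $p=(s,(\sigma,\mu))$, $s\in T(\Sigma,X)\cup\{\mathsf{e}\}$, $p(n)=s\sigma^n\mu$, $\mathit{Var}(p)=\mathit{Var}(s)\cup\mathit{Var}(\sigma)\cup\mathit{Var}(\mu)$;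 $\widehat{s}=(s,(\emptyset,\emptyset))$. A pattern rule $r=(p,q)$ has $\mathit{rules}(r)=\{(p(n),q(n))\mid n\in\mathbb N\}$; it is correct w.r.t. $P$ if $\mathit{rules}(r)\subseteq\mathit{binunf}(P)$ (sets: all elements). A pattern substitution is an mgu of two sequences of pattern terms if its $n$-th instance is an mgu of the $n$-th instances for every $n$. $[r]=\{r'\mid\mathit{rules}(r')\subseteq[\mathit{rules}(r)]\}$; $\ll_r$ extends to pattern rules via the variable sets. $\mathit{patid}=\{(\widehat{\mathsf{f}(x_1..x_m)},\widehat{\mathsf{f}(x_1..x_m)})\}$. $T^\pi_{P,B}(U)=[B]\cup[\{((u,(\sigma,\mu)),(v,(\sigma_i\sigma,\mu_i\mu)))\mid r=(u,\langle v_1..v_m\rangle)\in P,\ 1\le i\le m,\ \langle(p_1,\widehat{\mathsf{e}}),\dots,(p_{i-1},\widehat{\mathsf{e}}),(p_i,(v,(\sigma_i,\mu_i)))\rangle\ll_r U\cup\mathit{patid},\ v\ne\mathsf{e}\text{ if }i<m,\ (\sigma,\mu)\text{ an mgu of }\langle p_1..p_i\rangle,\langle\widehat{v_1}..\widehat{v_i}\rangle,\ \sigma\text{ commutes with }\sigma_i,\mu_i\}]$; $\mathit{patunf}(P,B)=\bigcup_n(T^\pi_{P,B})^n(\emptyset)$. $\Upsilon$ is a set of new unary symbols $c^{a,b}$ ($c\in\chi^{(1)}$, $a,b\in\mathbb N$); for $u\in T(\Sigma\cup\Upsilon,X)$, $u(n)$ replaces each $c^{a,b}$ by the nesting $c^{a\times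 n+b}$; $u\sim v$ iff $u(n)=v(n)$ for all $n$, $[u]$ its class. A pattern term $p=(s,(\sigma,\mu))$ is simple if for each $x\in\mathit{Var}(s)$, $\sigma(x)=c^a(x)$ and $\mu(x)=c^b(t)$ for some $c\in\chi^{(1)}$, $a,b\in\mathbb N$, $t\in T(\Sigma,X)$; then $\upsilon(p)=[s\theta_p]$ with $\theta_p(x)=\mu(x)$ if $\sigma(x)=x$ and $c^{a,b}(t)$ otherwise. A pattern rule $r=(p,q)$ is special if $p,q$ are simple and there exist an $m$-context $c$ with $\mathit{Var}(c)=\emptyset$, $c_1,\dots,c_m\in\chi^{(1)}$, naturals $a_i,b_i,a'_i,b'_i$, terms $t_i\in T(\Sigma,X)$ and $\rho\in S(\Sigma,X)$ with $c(c_1^{a_1,b_1}(t_1),\dots,c_m^{a_m,b_m}(t_m))\in\upsilon(p)$ and $c(c_1^{a'_1,b'_1}(t_1\rho),\dots,c_m^{a'_m,b'_m}(t_m\rho))\in\upsilon(q)$ such that: (1) each $t_i$ is a variable or ground; (2) $t_i\in X$, $t_i=t_j$ imply $c_i=c_j$; (3) $\{(a_i,a'_i)\mid t_i\text{ ground}\}=\{(h,h)\}$ with $h>0$ and $\{(a_i,a'_i)\mid t_i\in X\}=\{(a,a')\}$ with $a\le a'$; (4) $\{(b_i,b'_i)\mid t_i\text{ ground}\}=\{(b,b')\}$ with $b\le b'$ and $\{(b_i,b'_i)\mid t_i\in X\}=\{(d,d')\}$; (5) $k=(b'-b)/h\in\mathbb N$, and $a=a'$ implies $0\le(d'-d)-a\times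 k$. Then $\alpha(r)=0$ if $a=a'$ and $\alpha(r)=\frac{a\times k-(d'-d)}{a'-a}$ otherwise. -}

module Defs where

open import Level using (0ℓ)
open import Data.Nat as ℕ using (ℕ; zero; suc; _+_; _*_; _∸_; _≤_; _<_)
open import Data.Fin using (Fin; zero; suc)
open import Data.Vec as Vec using (Vec; []; _∷_; lookup; tabulate)
open import Data.List as List using (List; []; _∷_; _++_; zip; length; [_])
open import Data.List.Relation.Unary.All using (All)
open import Data.List.Relation.Unary.Any using (Any)
open import Data.List.Relation.Unary.AllPairs using (AllPairs)
open import Data.List.Membership.Propositional using (_∈_; _∉_)
open import Data.List.Membership.Propositional.Properties using (∈-++⁺ˡ; ∈-++⁺ʳ)
open import Data.Maybe as Maybe using (Maybe; just; nothing)
open import Data.Product using (Σ; _×_; _,_; proj₁; proj₂)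
open import Data.Sum using (_⊎_; inj₁; inj₂)
open import Data.Empty using (⊥)
open import Relation.Nullary using (¬_; Dec; yes; no)
open import Relation.Unary using (Pred; _∪_)
open import Relation.Binary.PropositionalEquality using (_≡_; _≢_; refl; trans)
open import Relation.Binary.Construct.Closure.Transitive using (TransClosure)
open import Data.Integer as ℤ using (ℤ; +_)
open import Data.Rational as ℚ using (ℚ)
open import Function.Definitions using (Bijective)

-- A signature Σ: function symbols with arities.
-- Variables X are ℕ (infinite countable); holes are a separate constructor;
-- the special constant e (= empty sequence) is represented by 'nothing'.

record Signature : Set₁ where
  field
    Sym   : Set
    arity : Sym → ℕ

module WithSig (Sg : Signature) where
  open Signature Sg

  -- Terms with holes □_1..□_m (hole i = □_(i+1)); Term = T(Σ,X) = Tm 0.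

  data Tm (m : ℕ) : Set where
    var  : ℕ → Tm m
    fn   : (f : Sym) → Vec (Tm m) (arity f) → Tm m
    hole : Fin m → Tm m

  Term : Set
  Term = Tm 0

  -- T(Σ,X) ∪ {e};  nothing = e
  TermE : Set
  TermE = Maybe Term

  mutual
    _∈v_ : ∀ {m} → ℕ → Tm m → Set
    x ∈v var y  = x ≡ y
    x ∈v fn f ts = x ∈vs ts
    x ∈v hole i = ⊥

    _∈vs_ : ∀ {m n} → ℕ → Vec (Tm m) n → Set
    x ∈vs []       = ⊥
    x ∈vs (t ∷ ts) = x ∈v t ⊎ x ∈vs ts

  _∈vE_ : ℕ → TermE → Set
  x ∈vE nothing = ⊥
  x ∈vE just t  = x ∈v t

  mutual
    HoleOcc : ∀ {m} → Fin m → Tm m → Set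
    HoleOcc i (var y)   = ⊥
    HoleOcc i (fn f ts) = HoleOccs i ts
    HoleOcc i (hole j)  = i ≡ j

    HoleOccs : ∀ {m n} → Fin m → Vec (Tm m) n → Set
    HoleOccs i []       = ⊥
    HoleOccs i (t ∷ ts) = HoleOcc i t ⊎ HoleOccs i ts

  mutual
    plug : ∀ {m k} → Tm m → Vec (Tm k) m → Tm k
    plug (var x)   ss = var x
    plug (fn f ts) ss = fn f (plugs ts ss)
    plug (hole i)  ss = lookup ss i

    plugs : ∀ {m k n} → Vec (Tm m) n → Vec (Tm k) m → Vec (Tm k) n
    plugs []       ss = []
    plugs (t ∷ ts) ss = plug t ss ∷ plugs ts ss

  -- m-context: contains each of □_1..□_m (and no other hole, by typing)
  IsContext : ∀ {m} → Tm m → Set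
  IsContext {m} c = ∀ (i : Fin m) → HoleOcc i c

  cpow : Tm 1 → ℕ → Tm 1
  cpow c zero    = hole zero
  cpow c (suc n) = plug c (cpow c n ∷ [])

  cpowApp : Tm 1 → ℕ → Term → Term
  cpowApp c n t = plug (cpow c n) (t ∷ [])

  record Chi1 : Set where
    field
      ctx     : Tm 1
      isCtx   : IsContext ctx
      noVar   : ∀ x → ¬ (x ∈v ctx)
  open Chi1 public

  record Subst : Set where
    constructor mkSubst
    field
      app    : ℕ → Term
      finite : Σ (List ℕ) λ D → ∀ x → x ∉ D → app x ≡ var x
  open Subst public

  mutual
    _⟪_⟫ : Term → Subst → Term
    var x   ⟪ σ ⟫ = app σ x
    fn f ts ⟪ σ ⟫ = fn f (ts ⟪ σ ⟫s)
    hole () ⟪ σ ⟫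

    _⟪_⟫s : ∀ {n} → Vec Term n → Subst → Vec Term n
    []       ⟪ σ ⟫s = []
    (t ∷ ts) ⟪ σ ⟫s = t ⟪ σ ⟫ ∷ ts ⟪ σ ⟫s

  _⟪_⟫ₑ : TermE → Subst → TermE
  nothing ⟪ σ ⟫ₑ = nothing
  just t  ⟪ σ ⟫ₑ = just (t ⟪ σ ⟫)

  idS : Subst
  idS = mkSubst var ([] , λ _ _ → refl)

  _∘ₛ_ : Subst → Subst → Subst
  _∘ₛ_ (mkSubst f (D , fD)) θ@(mkSubst g (E , gE)) =
    mkSubst (λ x → f x ⟪ θ ⟫) (D ++ E , pf)
    where
      pf : ∀ x → x ∉ D ++ E → f x ⟪ θ ⟫ ≡ var x
      pf x x∉ with f x | fD x (λ i → x∉ (∈-++⁺ˡ i))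
      ... | .(var x) | refl = gE x (λ i → x∉ (∈-++⁺ʳ D i))

  pow : Subst → ℕ → Subst
  pow σ zero    = idS
  pow σ (suc n) = pow σ n ∘ₛ σ

  Commutes : Subst → Subst → Set
  Commutes σ θ = ∀ x → app σ x ⟪ θ ⟫ ≡ app θ x ⟪ σ ⟫

  _∈vσ_ : ℕ → Subst → Set
  x ∈vσ σ = (app σ x ≢ var x) ⊎ Σ ℕ λ y → (app σ y ≢ var y) × x ∈v app σ y

  IsRenaming : Subst → Set
  IsRenaming ρ = Σ (ℕ → ℕ) λ f → (∀ x → app ρ x ≡ var (f x)) × Bijective _≡_ _≡_ f

  Eqns : Set
  Eqns = List (TermE × TermE)

  Unifies : Subst → Eqns → Set
  Unifies θ E = All (λ e → proj₁ e ⟪ θ ⟫ₑ ≡ proj₂ e ⟪ θ ⟫ₑ) E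

  IsMGU : Subst → Eqns → Set
  IsMGU θ E = Unifies θ E ×
    (∀ δ → Unifies δ E → Σ Subst λ γ → ∀ x → app δ x ≡ app θ x ⟪ γ ⟫)

  Rule : Set
  Rule = Term × List Term

  Program : Set₁
  Program = Pred Rule 0ℓ

  BinRule : Set
  BinRule = TermE × TermE

  _∈vR_ : ℕ → Rule → Set
  x ∈vR (u , vs) = x ∈v u ⊎ Any (x ∈v_) vs

  _∈vB_ : ℕ → BinRule → Set
  x ∈vB (u , v) = x ∈vE u ⊎ x ∈vE v

  renR : Subst → Rule → Rule
  renR ρ (u , vs) = (u ⟪ ρ ⟫ , List.map (_⟪ ρ ⟫) vs)

  renB : Subst → BinRule → BinRule
  renB ρ (u , v) = (u ⟪ ρ ⟫ₑ , v ⟪ ρ ⟫ₑ)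

  VariantR : Rule → Pred Rule 0ℓ
  VariantR r r' = Σ Subst λ ρ → IsRenaming ρ × r' ≡ renR ρ r

  VariantB : BinRule → Pred BinRule 0ℓ
  VariantB b b' = Σ Subst λ ρ → IsRenaming ρ × b' ≡ renB ρ b

  -- rs ≪_S U : elements of U, variable disjoint from S and from each other
  Apart : {A : Set} → (ℕ → A → Set) → (ℕ → Set) → List A → Pred A 0ℓ → Set
  Apart V S rs U =
    All U rs ×
    All (λ r → ∀ x → V x r → S x → ⊥) rs ×
    AllPairs (λ r r' → ∀ x → V x r → V x r' → ⊥) rs

  -- resolution steps ⇒_P on sequences (the empty list is e)
  data Step (P : Program) : List Term → List Term → Set where
    step : ∀ {s ss} (r : Rule) → P r → (u : Term) (vs : List Term) →
           Apart _∈vR_ (λ x → Any (x ∈v_) (s ∷ ss)) [ (u , vs) ] (VariantR r) →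
           (θ : Subst) → IsMGU θ [ (just u , just s) ] →
           Step P (s ∷ ss) (List.map (_⟪ θ ⟫) (vs ++ ss))

  Calls : Program → Term → Pred TermE 0ℓ
  Calls P s (just t) = Σ (List Term) λ ts → TransClosure (Step P) [ s ] (t ∷ ts)
  Calls P s nothing  = TransClosure (Step P) [ s ] []

  -- calls_P extended to T ∪ {e}; calls_P(e) = ∅ (⟨e⟩ = e has no step)
  CallsE : Program → TermE → Pred TermE 0ℓ
  CallsE P (just s) = Calls P s
  CallsE P nothing  = λ _ → ⊥

  Distinct : ∀ {n} → Vec ℕ n → Set
  Distinct xs = ∀ i j → lookup xs i ≡ lookup xs j → i ≡ j

  idTerm : (f : Sym) → Vec ℕ (arity f) → Term
  idTerm f xs = fn f (Vec.map var xs)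

  IdB : Pred BinRule 0ℓ
  IdB b = Σ Sym λ f → Σ (Vec ℕ (arity f)) λ xs →
          Distinct xs × b ≡ (just (idTerm f xs) , just (idTerm f xs))

  iter : {A : Set} → (Pred A 0ℓ → Pred A 0ℓ) → ℕ → Pred A 0ℓ
  iter F zero    = λ _ → ⊥
  iter F (suc n) = F (iter F n)

  -- the second set in the definition of T^β_P(U) (before renaming);
  -- body v̄ = ws ++ w ∷ zs, so i = length ws + 1 and i < m iff zs ≢ []
  record TβStep (P : Program) (U : Pred BinRule 0ℓ) (b : BinRule) : Set where
    field
      u      : Term
      vs     : List Term
      inP    : P (u , vs)
      ws     : List Term
      w      : Term
      zs     : List Term
      split  : vs ≡ ws ++ w ∷ zs
      pre    : List TermE
      preLen : length pre ≡ length ws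
      ui     : TermE
      v      : TermE
      apart  : Apart _∈vB_ (λ x → x ∈vR (u , vs))
                 (List.map (λ y → (y , nothing)) pre ++ [ (ui , v) ]) (U ∪ IdB)
      notE   : zs ≢ [] → v ≢ nothing
      θ      : Subst
      mgu    : IsMGU θ (zip pre (List.map just ws) ++ [ (ui , just w) ])
      result : b ≡ (just (u ⟪ θ ⟫) , v ⟪ θ ⟫ₑ)

  Tβ : Program → Pred BinRule 0ℓ → Pred BinRule 0ℓ
  Tβ P U b =
    (Σ Term λ u → P (u , []) × VariantB (just u , nothing) b) ⊎
    (Σ BinRule λ b₀ → TβStep P U b₀ × VariantB b₀ b)

  binunf : Program → Pred BinRule 0ℓ
  binunf P b = Σ ℕ λ n → iter (Tβ P) n b

  record PatTerm : Set where
    constructor pat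
    field
      s : TermE
      σ : Subst
      μ : Subst

  inst : PatTerm → ℕ → TermE
  inst (pat s σ μ) n = s ⟪ pow σ n ∘ₛ μ ⟫ₑ

  hat : TermE → PatTerm
  hat s = pat s idS idS

  _∈vP_ : ℕ → PatTerm → Set
  x ∈vP (pat s σ μ) = x ∈vE s ⊎ x ∈vσ σ ⊎ x ∈vσ μ

  PatRule : Set
  PatRule = PatTerm × PatTerm

  _∈vPR_ : ℕ → PatRule → Set
  x ∈vPR (p , q) = x ∈vP p ⊎ x ∈vP q

  rulesAt : PatRule → ℕ → BinRule
  rulesAt (p , q) n = (inst p n , inst q n)

  Correct : Program → Pred PatRule 0ℓ → Set
  Correct P B = ∀ r → B r → ∀ n → binunf P (rulesAt r n)

  VariantP : PatRule → Pred PatRule 0ℓ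
  VariantP r r' = ∀ n → Σ ℕ λ m → VariantB (rulesAt r m) (rulesAt r' n)

  PatId : Pred PatRule 0ℓ
  PatId r = Σ Sym λ f → Σ (Vec ℕ (arity f)) λ xs →
            Distinct xs × r ≡ (hat (just (idTerm f xs)) , hat (just (idTerm f xs)))

  -- the second set in the definition of T^π_{P,B}(U) (before renaming)
  record TπStep (P : Program) (U : Pred PatRule 0ℓ) (r : PatRule) : Set where
    field
      u      : Term
      vs     : List Term
      inP    : P (u , vs)
      ws     : List Term
      w      : Term
      zs     : List Term
      split  : vs ≡ ws ++ w ∷ zs
      pre    : List PatTerm
      preLen : length pre ≡ length ws
      pᵢ     : PatTerm
      v      : TermE
      σᵢ     : Subst
      μᵢ     : Subst
      apart  : Apart _∈vPR_ (λ x → x ∈vR (u , vs))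
                 (List.map (λ p → (p , hat nothing)) pre ++ [ (pᵢ , pat v σᵢ μᵢ) ])
                 (U ∪ PatId)
      notE   : zs ≢ [] → v ≢ nothing
      σ      : Subst
      μ      : Subst
      mgu    : ∀ n → IsMGU (pow σ n ∘ₛ μ)
                 (zip (List.map (λ p → inst p n) pre)
                      (List.map (λ t → inst (hat (just t)) n) ws)
                  ++ [ (inst pᵢ n , inst (hat (just w)) n) ])
      commσ  : Commutes σ σᵢ
      commμ  : Commutes σ μᵢ
      result : r ≡ (pat (just u) σ μ , pat v (σᵢ ∘ₛ σ) (μᵢ ∘ₛ μ))

  Tπ : Program → Pred PatRule 0ℓ → Pred PatRule 0ℓ → Pred PatRule 0ℓ
  Tπ P B U r =
    (Σ PatRule λ b → B b × VariantP b r) ⊎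
    (Σ PatRule λ r₀ → TπStep P U r₀ × VariantP r₀ r)

  patunf : Program → Pred PatRule 0ℓ → Pred PatRule 0ℓ
  patunf P B r = Σ ℕ λ n → iter (Tπ P B) n r

  -- Terms over Σ ∪ Υ, with Υ = { c^{a,b} | c ∈ χ^(1), a b ∈ ℕ }

  data UTm : Set where
    uvar : ℕ → UTm
    ufn  : (f : Sym) → Vec UTm (arity f) → UTm
    up   : Chi1 → ℕ → ℕ → UTm → UTm

  mutual
    eval : UTm → ℕ → Term
    eval (uvar x)     n = var x
    eval (ufn f us)   n = fn f (evals us n)
    eval (up c a b u) n = cpowApp (ctx c) (a * n + b) (eval u n)

    evals : ∀ {k} → Vec UTm k → ℕ → Vec Term k
    evals []       n = []
    evals (u ∷ us) n = eval u n ∷ evals us n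

  _∼_ : UTm → UTm → Set
  u ∼ v = ∀ n → eval u n ≡ eval v n

  mutual
    embedU : Term → UTm
    embedU (var x)   = uvar x
    embedU (fn f ts) = ufn f (embedUs ts)
    embedU (hole ())

    embedUs : ∀ {k} → Vec Term k → Vec UTm k
    embedUs []       = []
    embedUs (t ∷ ts) = embedU t ∷ embedUs ts

  mutual
    plugU : ∀ {m} → Tm m → Vec UTm m → UTm
    plugU (var x)   us = uvar x
    plugU (fn f ts) us = ufn f (plugUs ts us)
    plugU (hole i)  us = lookup us i

    plugUs : ∀ {m k} → Vec (Tm m) k → Vec UTm m → Vec UTm k
    plugUs []       us = []
    plugUs (t ∷ ts) us = plugU t us ∷ plugUs ts us

  -- s θ, θ only needed on the variables of s
  mutual
    subOcc : (s : Term) → (∀ x → x ∈v s → UTm) → UTm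
    subOcc (var y)   f = f y refl
    subOcc (fn g ts) f = ufn g (subOccs ts f)
    subOcc (hole ()) f

    subOccs : ∀ {k} (ts : Vec Term k) → (∀ x → x ∈vs ts → UTm) → Vec UTm k
    subOccs []       f = []
    subOccs (t ∷ ts) f = subOcc t (λ x o → f x (inj₁ o)) ∷ subOccs ts (λ x o → f x (inj₂ o))

  record SimpleAt (σ μ : Subst) (x : ℕ) : Set where
    field
      c   : Chi1
      a   : ℕ
      b   : ℕ
      t   : Term
      eqσ : app σ x ≡ cpowApp (ctx c) a (var x)
      eqμ : app μ x ≡ cpowApp (ctx c) b t
      dec : Dec (app σ x ≡ var x)

  thetaAt : ∀ {σ μ x} → SimpleAt σ μ x → UTm
  thetaAt {σ} {μ} {x} w with SimpleAt.dec w
  ... | yes _ = embedU (app μ x)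
  ... | no  _ = up (SimpleAt.c w) (SimpleAt.a w) (SimpleAt.b w) (embedU (SimpleAt.t w))

  Simple : PatTerm → Set
  Simple (pat s σ μ) = ∀ x → x ∈vE s → SimpleAt σ μ x

  upsRep : (p : PatTerm) → Simple p → Maybe UTm
  upsRep (pat nothing σ μ)  W = nothing
  upsRep (pat (just s) σ μ) W = just (subOcc s (λ x o → thetaAt (W x o)))

  -- u ∈ υ(p) = [s θ_p]
  InUps : (p : PatTerm) → Simple p → UTm → Set
  InUps p W u = Σ UTm λ u' → upsRep p W ≡ just u' × u ∼ u'

  IsVar : Term → Set
  IsVar t = Σ ℕ λ x → t ≡ var x

  Ground : Term → Set
  Ground t = ∀ x → ¬ (x ∈v t)

  record Special (r : PatRule) : Set where
    field
      simpP  : Simple (proj₁ r)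
      simpQ  : Simple (proj₂ r)
      m      : ℕ
      c      : Tm m
      cCtx   : IsContext c
      cNoVar : ∀ x → ¬ (x ∈v c)
      cs     : Fin m → Chi1
      as     : Fin m → ℕ
      bs     : Fin m → ℕ
      as'    : Fin m → ℕ
      bs'    : Fin m → ℕ
      ts     : Fin m → Term
      ρ      : Subst
      inP    : InUps (proj₁ r) simpP
                 (plugU c (tabulate λ i → up (cs i) (as i) (bs i) (embedU (ts i))))
      inQ    : InUps (proj₂ r) simpQ
                 (plugU c (tabulate λ i → up (cs i) (as' i) (bs' i) (embedU (ts i ⟪ ρ ⟫))))
      cond1  : ∀ i → IsVar (ts i) ⊎ Ground (ts i)
      cond2  : ∀ i j → IsVar (ts i) → ts i ≡ ts j → ctx (cs i) ≡ ctx (cs j)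
      h      : ℕ
      h>0    : 0 < h
      gEx    : Σ (Fin m) λ i → Ground (ts i)
      gA     : ∀ i → Ground (ts i) → as i ≡ h × as' i ≡ h
      a      : ℕ
      a'     : ℕ
      vEx    : Σ (Fin m) λ i → IsVar (ts i)
      vA     : ∀ i → IsVar (ts i) → as i ≡ a × as' i ≡ a'
      a≤a'   : a ≤ a'
      b      : ℕ
      b'     : ℕ
      gB     : ∀ i → Ground (ts i) → bs i ≡ b × bs' i ≡ b'
      b≤b'   : b ≤ b'
      d      : ℕ
      d'     : ℕ
      vB     : ∀ i → IsVar (ts i) → bs i ≡ d × bs' i ≡ d'
      -- (5)  k = (b' - b) / h ∈ ℕ
      k      : ℕ
      kEq    : k * h ≡ b' ∸ b
      cond5  : a ≡ a' → ℤ.0ℤ ℤ.≤ ((+ d' ℤ.- + d) ℤ.- + (a * k))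

  -- α(r) = 0 if a = a', and (a×k − (d'−d)) / (a'−a) otherwise (a ≤ a')
  alphaQ : ℕ → ℕ → ℤ → ℚ
  alphaQ a a' x with a' ∸ a
  ... | zero  = ℚ.0ℚ
  ... | suc j = x ℚ./ suc j

  alpha : ∀ {r} → Special r → ℚ
  alpha W = alphaQ a a' (+ (a * k) ℤ.- (+ d' ℤ.- + d))
    where open Special W

  ℕtoℚ : ℕ → ℚ
  ℕtoℚ n = + n ℚ./ 1

{-# OPTIONS --safe #-}
module Submission where

-- Every instance (p(n), q(n)) of a pattern rule of patunf P B lies in binunf P, since T^π
-- instantiates pointwise to T^β.  Every rule (u, v) of binunf P is sound for calls: resolving
-- an instance of u reaches a call that is an instance of v, except through an identity rule,
-- which only predicts a flat instance of the call; a special rule's q(n) has no flat instance.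
-- For a special rule the ground arguments of p(n + k) and q(n) agree because h k = b′ − b, and
-- n ≥ α(r) says exactly that the variable arguments of p(n + k) are no deeper than those of
-- q(n), so deepening them turns p(n + k) into any given instance of q(n).

open import Defs
open import Level using (0ℓ)
open import Data.Nat as ℕ using (ℕ; zero; suc; _+_; _*_; _∸_; _<_; z≤n; s≤s; _⊔_; _<?_; _≟_)
open import Data.Nat.Properties
open import Data.Integer as ℤ using (ℤ; +_)
import Data.Integer.Properties as ℤP
import Data.Integer.Solver as ℤSolver
import Data.Nat.Solver as ℕSolver
import Data.Rational as ℚ
import Data.Rational.Properties as ℚP
import Data.Rational.Unnormalised as ℚᵘ
import Data.Rational.Unnormalised.Properties as ℚᵘP
open import Data.Fin using (Fin; zero; suc)
import Data.Fin.Properties as FinP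
open import Data.Vec as Vec using (Vec; []; _∷_; lookup; tabulate)
import Data.Vec.Properties as VecP
open import Data.List as List using (List; []; _∷_; _++_; [_]; zip; length; upTo)
open import Data.List.Properties using (map-++; ++-assoc; length-map; map-cong; map-∘)
open import Data.List.Relation.Unary.All as All using (All; []; _∷_)
import Data.List.Relation.Unary.All.Properties as AllP
open import Data.List.Relation.Unary.Any as Any using (Any; here; there)
import Data.List.Relation.Unary.Any.Properties as AnyP
open import Data.List.Relation.Binary.Pointwise using (Pointwise; []; _∷_)
open import Data.List.Relation.Unary.AllPairs as AllPairs using (AllPairs; []; _∷_)
import Data.List.Relation.Unary.AllPairs.Properties as AllPairsP
open import Data.List.Membership.Propositional using (_∈_; _∉_; lose)
open import Data.List.Membership.Propositional.Properties using (∈-upTo⁺)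
open import Data.Maybe using (Maybe; just; nothing)
open import Data.Maybe.Properties using (just-injective)
open import Data.Product using (Σ; _×_; _,_; proj₁; proj₂; swap)
open import Data.Sum using (_⊎_; inj₁; inj₂; [_,_]′)
open import Data.Empty using (⊥; ⊥-elim)
open import Relation.Nullary using (¬_; Dec; yes; no)
open import Relation.Unary using (Pred; _∪_)
open import Relation.Binary.PropositionalEquality hiding ([_])
open import Relation.Binary.Bundles using (Setoid)
import Relation.Binary.Reasoning.Setoid as SetoidReasoning
open import Relation.Binary.Construct.Closure.Transitive as Plus using (TransClosure)
open import Relation.Binary.Construct.Closure.ReflexiveTransitive using (Star; ε; _◅_; _◅◅_)

module _ where
  -- ℕ's _≤_ is opened only locally, since the theorem is stated with ℚ's.
  open import Data.Nat using (_≤_)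

  [A-[C-B]]≤N⇒A+B≤N+C : ∀ A B C N → (+ A ℤ.- (+ C ℤ.- + B)) ℤ.≤ + N → A + B ≤ N + C
  [A-[C-B]]≤N⇒A+B≤N+C A B C N h =
    ℤP.drop‿+≤+ (subst₂ ℤ._≤_ lhs (sym (ℤP.pos-+ N C)) (ℤP.+-monoˡ-≤ (+ C) h))
    where
      open ℤSolver.+-*-Solver
      lhs : (+ A ℤ.- (+ C ℤ.- + B)) ℤ.+ + C ≡ + (A + B)
      lhs = trans (solve 3 (λ a b c → (a :- (c :- b)) :+ c := a :+ b) refl (+ A) (+ B) (+ C)) (sym (ℤP.pos-+ A B))

  0≤[C-B]-A⇒B+A≤C : ∀ A B C → ℤ.0ℤ ℤ.≤ ((+ C ℤ.- + B) ℤ.- + A) → B + A ≤ C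
  0≤[C-B]-A⇒B+A≤C A B C h = ℤP.drop‿+≤+ (subst₂ ℤ._≤_ lhs rhs (ℤP.+-monoˡ-≤ (+ B ℤ.+ + A) h))
    where
      open ℤSolver.+-*-Solver
      lhs : ℤ.0ℤ ℤ.+ (+ B ℤ.+ + A) ≡ + (B + A)
      lhs = trans (ℤP.+-identityˡ (+ B ℤ.+ + A)) (sym (ℤP.pos-+ B A))
      rhs : ((+ C ℤ.- + B) ℤ.- + A) ℤ.+ (+ B ℤ.+ + A) ≡ + C
      rhs = solve 3 (λ a b c → ((c :- b) :- a) :+ (b :+ a) := c) refl (+ A) (+ B) (+ C)

  -- ℚ's _/_ normalises, so the comparison is transported to the unnormalised rationals.
  X/[1+j]≤n⇒X≤n*[1+j] : ∀ (X : ℤ) j n → (X ℚ./ suc j) ℚ.≤ (+ n ℚ./ 1) → X ℤ.≤ + (n * suc j)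
  X/[1+j]≤n⇒X≤n*[1+j] X j n h
    with ℚᵘP.≤-respʳ-≃ (ℚP.toℚᵘ-fromℚᵘ (ℚᵘ.mkℚᵘ (+ n) 0))
           (ℚᵘP.≤-respˡ-≃ (ℚP.toℚᵘ-fromℚᵘ (ℚᵘ.mkℚᵘ X j)) (ℚP.toℚᵘ-mono-≤ h))
  ... | ℚᵘ.*≤* X*1≤n*[1+j] = subst₂ ℤ._≤_ (ℤP.*-identityʳ X) (sym (ℤP.pos-* n (suc j))) X*1≤n*[1+j]

  -- With a < a′ the bound is n ≥ (a k − (d′ − d)) / (a′ − a), stated here after clearing the
  -- denominator.
  shift-fits : ∀ a a′ k d d′ n → a ≤ a′ → (a ≡ a′ → ℤ.0ℤ ℤ.≤ ((+ d′ ℤ.- + d) ℤ.- + (a * k))) →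
               (∀ j → a′ ∸ a ≡ suc j → (+ (a * k) ℤ.- (+ d′ ℤ.- + d)) ℤ.≤ + (n * suc j)) →
               a * (n + k) + d ≤ a′ * n + d′
  shift-fits a a′ k d d′ n a≤a′ cond5 α≤n with a′ ∸ a in a′∸a≡
  ... | zero = begin
    a * (n + k) + d      ≡⟨ distrib ⟩
    a * n + (a * k + d)  ≡⟨ cong (_+_ (a * n)) (+-comm (a * k) d) ⟩
    a * n + (d + a * k)  ≤⟨ +-monoʳ-≤ (a * n) (0≤[C-B]-A⇒B+A≤C (a * k) d d′ (cond5 a≡a′)) ⟩
    a * n + d′           ≡⟨ cong (λ e → e * n + d′) a≡a′ ⟩
    a′ * n + d′          ∎
    where
      open ≤-Reasoning
      a≡a′ = ≤-antisym a≤a′ (m∸n≡0⇒m≤n a′∸a≡)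
      distrib = trans (cong (_+ d) (*-distribˡ-+ a n k)) (+-assoc (a * n) (a * k) d)
  ... | suc j = begin
    a * (n + k) + d            ≡⟨ trans (cong (_+ d) (*-distribˡ-+ a n k)) (+-assoc (a * n) (a * k) d) ⟩
    a * n + (a * k + d)        ≤⟨ +-monoʳ-≤ (a * n) ([A-[C-B]]≤N⇒A+B≤N+C (a * k) d d′ (n * suc j) (α≤n j refl)) ⟩
    a * n + (n * suc j + d′)   ≡⟨ sym (+-assoc (a * n) (n * suc j) d′) ⟩
    a * n + n * suc j + d′     ≡⟨ cong (λ e → a * n + e + d′) (trans (*-comm n (suc j)) (cong (_* n) (sym a′∸a≡))) ⟩
    a * n + (a′ ∸ a) * n + d′  ≡⟨ cong (_+ d′) (trans (sym (*-distribʳ-+ n a (a′ ∸ a))) (cong (_* n) (m+[n∸m]≡n a≤a′))) ⟩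
    a′ * n + d′                ∎
    where open ≤-Reasoning

module _ (Sg : Signature) where
  open Signature Sg
  open WithSig Sg
  open import Data.Nat using (_≤_)

  var-injective : ∀ {m} {x y : ℕ} → var {m} x ≡ var y → x ≡ y
  var-injective refl = refl

  fn-injectiveˡ : ∀ {m f g} {ts : Vec (Tm m) (arity f)} {us : Vec (Tm m) (arity g)} →
                  fn f ts ≡ fn g us → f ≡ g
  fn-injectiveˡ refl = refl

  fn-injectiveʳ : ∀ {m f} {ts us : Vec (Tm m) (arity f)} → fn f ts ≡ fn f us → ts ≡ us
  fn-injectiveʳ refl = refl

  _≟var_ : ∀ (t : Term) x → Dec (t ≡ var x)
  var y ≟var x with y ≟ x
  ... | yes refl = yes refl
  ... | no y≢x = no (λ e → y≢x (var-injective e))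
  fn f ts ≟var x = no (λ ())

  mutual
    _∈v?_ : ∀ {m} x (t : Tm m) → Dec (x ∈v t)
    x ∈v? var y = x ≟ y
    x ∈v? fn f ts = x ∈vs? ts
    x ∈v? hole i = no (λ ())

    _∈vs?_ : ∀ {m n} x (ts : Vec (Tm m) n) → Dec (x ∈vs ts)
    x ∈vs? [] = no (λ ())
    x ∈vs? (t ∷ ts) with x ∈v? t | x ∈vs? ts
    ... | yes o | _ = yes (inj₁ o)
    ... | no _ | yes o = yes (inj₂ o)
    ... | no o | no o′ = no [ o , o′ ]′

  _∈vE?_ : ∀ x (t : TermE) → Dec (x ∈vE t)
  x ∈vE? nothing = no (λ ())
  x ∈vE? just t = x ∈v? t

  _∈vL?_ : ∀ x (ts : List Term) → Dec (Any (x ∈v_) ts)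
  x ∈vL? ts = Any.any? (x ∈v?_) ts

  _∈vR?_ : ∀ x (r : Rule) → Dec (x ∈vR r)
  x ∈vR? (u , vs) with x ∈v? u | x ∈vL? vs
  ... | yes o | _ = yes (inj₁ o)
  ... | no _ | yes o = yes (inj₂ o)
  ... | no o | no o′ = no [ o , o′ ]′

  _∈vB?_ : ∀ x (r : BinRule) → Dec (x ∈vB r)
  x ∈vB? (u , v) with x ∈vE? u | x ∈vE? v
  ... | yes o | _ = yes (inj₁ o)
  ... | no _ | yes o = yes (inj₂ o)
  ... | no o | no o′ = no [ o , o′ ]′

  _≗ₛ_ : Subst → Subst → Set
  σ ≗ₛ τ = ∀ x → app σ x ≡ app τ x

  mutual
    sub-local : ∀ {σ τ} (t : Term) → (∀ x → x ∈v t → app σ x ≡ app τ x) → t ⟪ σ ⟫ ≡ t ⟪ τ ⟫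
    sub-local (var x) h = h x refl
    sub-local (fn f ts) h = cong (fn f) (subs-local ts h)

    subs-local : ∀ {σ τ n} (ts : Vec Term n) → (∀ x → x ∈vs ts → app σ x ≡ app τ x) →
                 ts ⟪ σ ⟫s ≡ ts ⟪ τ ⟫s
    subs-local [] h = refl
    subs-local (t ∷ ts) h = cong₂ _∷_ (sub-local t (λ x o → h x (inj₁ o))) (subs-local ts (λ x o → h x (inj₂ o)))

  sub-localₑ : ∀ {σ τ} (t : TermE) → (∀ x → x ∈vE t → app σ x ≡ app τ x) → t ⟪ σ ⟫ₑ ≡ t ⟪ τ ⟫ₑ
  sub-localₑ nothing h = refl
  sub-localₑ (just t) h = cong just (sub-local t h)

  sub-cong : ∀ {σ τ} → σ ≗ₛ τ → ∀ t → t ⟪ σ ⟫ ≡ t ⟪ τ ⟫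
  sub-cong h t = sub-local t (λ x _ → h x)

  sub-congₑ : ∀ {σ τ} → σ ≗ₛ τ → ∀ t → t ⟪ σ ⟫ₑ ≡ t ⟪ τ ⟫ₑ
  sub-congₑ h t = sub-localₑ t (λ x _ → h x)

  mutual
    sub-∘ : ∀ (t : Term) σ τ → t ⟪ σ ∘ₛ τ ⟫ ≡ t ⟪ σ ⟫ ⟪ τ ⟫
    sub-∘ (var x) σ τ = refl
    sub-∘ (fn f ts) σ τ = cong (fn f) (subs-∘ ts σ τ)

    subs-∘ : ∀ {n} (ts : Vec Term n) σ τ → ts ⟪ σ ∘ₛ τ ⟫s ≡ ts ⟪ σ ⟫s ⟪ τ ⟫s
    subs-∘ [] σ τ = refl
    subs-∘ (t ∷ ts) σ τ = cong₂ _∷_ (sub-∘ t σ τ) (subs-∘ ts σ τ)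

  sub-∘ₑ : ∀ (t : TermE) σ τ → t ⟪ σ ∘ₛ τ ⟫ₑ ≡ t ⟪ σ ⟫ₑ ⟪ τ ⟫ₑ
  sub-∘ₑ nothing σ τ = refl
  sub-∘ₑ (just t) σ τ = cong just (sub-∘ t σ τ)

  mutual
    sub-id : ∀ (t : Term) → t ⟪ idS ⟫ ≡ t
    sub-id (var x) = refl
    sub-id (fn f ts) = cong (fn f) (subs-id ts)

    subs-id : ∀ {n} (ts : Vec Term n) → ts ⟪ idS ⟫s ≡ ts
    subs-id [] = refl
    subs-id (t ∷ ts) = cong₂ _∷_ (sub-id t) (subs-id ts)

  sub-idₑ : ∀ (t : TermE) → t ⟪ idS ⟫ₑ ≡ t
  sub-idₑ nothing = refl
  sub-idₑ (just t) = cong just (sub-id t)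

  sub-fixed : ∀ {σ} → (∀ x → app σ x ≡ var x) → ∀ t → t ⟪ σ ⟫ ≡ t
  sub-fixed {σ} h t = trans (sub-cong {σ} {idS} h t) (sub-id t)

  sub-ground : ∀ {t} → Ground t → ∀ σ → t ⟪ σ ⟫ ≡ t
  sub-ground {t} g σ = trans (sub-local {σ} {idS} t (λ x o → ⊥-elim (g x o))) (sub-id t)

  ∘ₛ-assoc : ∀ α β γ → ((α ∘ₛ β) ∘ₛ γ) ≗ₛ (α ∘ₛ (β ∘ₛ γ))
  ∘ₛ-assoc α β γ x = sym (sub-∘ (app α x) β γ)

  ∘ₛ-congˡ : ∀ α α′ β → α ≗ₛ α′ → (α ∘ₛ β) ≗ₛ (α′ ∘ₛ β)
  ∘ₛ-congˡ α α′ β h x = cong (_⟪ β ⟫) (h x)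

  ∘ₛ-congʳ : ∀ α β β′ → β ≗ₛ β′ → (α ∘ₛ β) ≗ₛ (α ∘ₛ β′)
  ∘ₛ-congʳ α β β′ h x = sub-cong h (app α x)

  ∘ₛ-identityʳ : ∀ α → (α ∘ₛ idS) ≗ₛ α
  ∘ₛ-identityʳ α x = sub-id (app α x)

  mutual
    ∈v-sub⁻ : ∀ {x} (t : Term) σ → x ∈v (t ⟪ σ ⟫) → Σ ℕ λ y → y ∈v t × x ∈v app σ y
    ∈v-sub⁻ (var y) σ o = y , refl , o
    ∈v-sub⁻ (fn f ts) σ o = ∈vs-sub⁻ ts σ o

    ∈vs-sub⁻ : ∀ {x n} (ts : Vec Term n) σ → x ∈vs (ts ⟪ σ ⟫s) → Σ ℕ λ y → y ∈vs ts × x ∈v app σ y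
    ∈vs-sub⁻ (t ∷ ts) σ (inj₁ o) with ∈v-sub⁻ t σ o
    ... | y , y∈t , x∈σy = y , inj₁ y∈t , x∈σy
    ∈vs-sub⁻ (t ∷ ts) σ (inj₂ o) with ∈vs-sub⁻ ts σ o
    ... | y , y∈ts , x∈σy = y , inj₂ y∈ts , x∈σy

  mapsub : Subst → List Term → List Term
  mapsub σ = List.map (_⟪ σ ⟫)

  mapsub-∘ : ∀ σ τ ts → mapsub τ (mapsub σ ts) ≡ mapsub (σ ∘ₛ τ) ts
  mapsub-∘ σ τ [] = refl
  mapsub-∘ σ τ (t ∷ ts) = cong₂ _∷_ (sym (sub-∘ t σ τ)) (mapsub-∘ σ τ ts)

  mapsub-id : ∀ ts → mapsub idS ts ≡ ts
  mapsub-id [] = refl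
  mapsub-id (t ∷ ts) = cong₂ _∷_ (sub-id t) (mapsub-id ts)

  ∈vL-sub⁻ : ∀ {x} ts σ → Any (x ∈v_) (mapsub σ ts) → Σ ℕ λ y → Any (y ∈v_) ts × x ∈v app σ y
  ∈vL-sub⁻ (t ∷ ts) σ (here o) with ∈v-sub⁻ t σ o
  ... | y , y∈t , x∈σy = y , here y∈t , x∈σy
  ∈vL-sub⁻ (t ∷ ts) σ (there o) with ∈vL-sub⁻ ts σ o
  ... | y , y∈ts , x∈σy = y , there y∈ts , x∈σy

  VarsBelow : ℕ → Term → Set
  VarsBelow K t = ∀ x → x ∈v t → x < K

  VarsBelow-mono : ∀ {K K′} → K ≤ K′ → ∀ t → VarsBelow K t → VarsBelow K′ t
  VarsBelow-mono K≤K′ t b x o = ≤-trans (b x o) K≤K′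

  VarsBelow-sub : ∀ {K K′} σ t → VarsBelow K t → (∀ y → y < K → VarsBelow K′ (app σ y)) →
                  VarsBelow K′ (t ⟪ σ ⟫)
  VarsBelow-sub σ t b h x o with ∈v-sub⁻ t σ o
  ... | y , y∈t , x∈σy = h y (b y y∈t) x x∈σy

  VarsBelow-mapsub : ∀ {K K′} σ ts → All (VarsBelow K) ts → (∀ y → y < K → VarsBelow K′ (app σ y)) →
                     All (VarsBelow K′) (mapsub σ ts)
  VarsBelow-mapsub σ ts bs h = AllP.map⁺ (All.map (λ {t} b → VarsBelow-sub σ t b h) bs)

  VarsBelow-var : ∀ {K y} → y < K → VarsBelow K (var y)
  VarsBelow-var y<K x refl = y<K

  AnyVarsBelow : ∀ {K x} {ts : List Term} → All (VarsBelow K) ts → Any (x ∈v_) ts → x < K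
  AnyVarsBelow (b ∷ _) (here o) = b _ o
  AnyVarsBelow (_ ∷ bs) (there o) = AnyVarsBelow bs o

  mutual
    varBound : Term → ℕ
    varBound (var x) = suc x
    varBound (fn f ts) = varBounds ts

    varBounds : ∀ {n} → Vec Term n → ℕ
    varBounds [] = 0
    varBounds (t ∷ ts) = varBound t ⊔ varBounds ts

  mutual
    varBound-correct : ∀ t → VarsBelow (varBound t) t
    varBound-correct (var x) .x refl = ≤-refl
    varBound-correct (fn f ts) = varBounds-correct ts

    varBounds-correct : ∀ {n} (ts : Vec Term n) x → x ∈vs ts → x < varBounds ts
    varBounds-correct (t ∷ ts) x (inj₁ o) = ≤-trans (varBound-correct t x o) (m≤m⊔n _ _)
    varBounds-correct (t ∷ ts) x (inj₂ o) = ≤-trans (varBounds-correct ts x o) (m≤n⊔m _ _)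

  varBoundL : List Term → ℕ
  varBoundL = List.foldr (λ t K → varBound t ⊔ K) 0

  varBoundL-correct : ∀ ts → All (VarsBelow (varBoundL ts)) ts
  varBoundL-correct [] = []
  varBoundL-correct (t ∷ ts) =
    VarsBelow-mono (m≤m⊔n _ _) t (varBound-correct t) ∷
    All.map (λ {t′} → VarsBelow-mono (m≤n⊔m (varBound t) _) t′) (varBoundL-correct ts)

  varBoundE : TermE → ℕ
  varBoundE nothing = 0
  varBoundE (just t) = varBound t

  varBoundE-correct : ∀ t x → x ∈vE t → x < varBoundE t
  varBoundE-correct (just t) = varBound-correct t

  varBoundR : Rule → ℕ
  varBoundR (u , vs) = varBound u ⊔ varBoundL vs

  varBoundR-correct : ∀ r x → x ∈vR r → x < varBoundR r
  varBoundR-correct (u , vs) x (inj₁ o) = ≤-trans (varBound-correct u x o) (m≤m⊔n _ _)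
  varBoundR-correct (u , vs) x (inj₂ o) = ≤-trans (AnyVarsBelow (varBoundL-correct vs) o) (m≤n⊔m _ _)

  varBoundB : BinRule → ℕ
  varBoundB (u , v) = varBoundE u ⊔ varBoundE v

  varBoundB-correct : ∀ r x → x ∈vB r → x < varBoundB r
  varBoundB-correct (u , v) x (inj₁ o) = ≤-trans (varBoundE-correct u x o) (m≤m⊔n _ _)
  varBoundB-correct (u , v) x (inj₂ o) = ≤-trans (varBoundE-correct v x o) (m≤n⊔m _ _)

  varBoundBs : List BinRule → ℕ
  varBoundBs = List.foldr (λ r K → varBoundB r ⊔ K) 0

  substBelow : (f : ℕ → Term) (B : ℕ) → (∀ x → B ≤ x → f x ≡ var x) → Subst
  substBelow f B fixed = mkSubst f (upTo B , λ x x∉ → fixed x (≮⇒≥ (λ x<B → x∉ (∈-upTo⁺ x<B))))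

  idS-renaming : IsRenaming idS
  idS-renaming = (λ x → x) , (λ x → refl) , (λ e → e) , λ y → y , λ e → e

  ∘ₛ-renaming : ∀ {ρ ρ′} → IsRenaming ρ → IsRenaming ρ′ → IsRenaming (ρ ∘ₛ ρ′)
  ∘ₛ-renaming {ρ} {ρ′} (f , ρ≡f , f-inj , f-surj) (g , ρ′≡g , g-inj , g-surj) =
    (λ x → g (f x)) ,
    (λ x → trans (cong (_⟪ ρ′ ⟫) (ρ≡f x)) (ρ′≡g (f x))) ,
    (λ e → f-inj (g-inj e)) ,
    λ z → proj₁ (f-surj (proj₁ (g-surj z))) ,
          λ e → trans (cong g (proj₂ (f-surj (proj₁ (g-surj z))) e)) (proj₂ (g-surj z) refl)

  module _ (ρ : Subst) (R : IsRenaming ρ) where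
    private
      f : ℕ → ℕ
      f = proj₁ R
      ρ≡f : ∀ x → app ρ x ≡ var (f x)
      ρ≡f = proj₁ (proj₂ R)
      f-inj : ∀ {x y} → f x ≡ f y → x ≡ y
      f-inj = proj₁ (proj₂ (proj₂ R))
      f⁻¹ : ℕ → ℕ
      f⁻¹ y = proj₁ (proj₂ (proj₂ (proj₂ R)) y)
      f∘f⁻¹ : ∀ y → f (f⁻¹ y) ≡ y
      f∘f⁻¹ y = proj₂ (proj₂ (proj₂ (proj₂ R)) y) refl

    renaming-inverse : Subst
    renaming-inverse = mkSubst (λ y → var (f⁻¹ y)) (proj₁ (finite ρ) , fixed)
      where
        fixed : ∀ y → y ∉ proj₁ (finite ρ) → var (f⁻¹ y) ≡ var y
        fixed y y∉ = cong var (f-inj (trans (f∘f⁻¹ y)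
                       (sym (var-injective (trans (sym (ρ≡f y)) (proj₂ (finite ρ) y y∉))))))

    renaming-inverse-cancel : ∀ t → t ⟪ ρ ⟫ ⟪ renaming-inverse ⟫ ≡ t
    renaming-inverse-cancel t =
      trans (sym (sub-∘ t ρ renaming-inverse))
            (sub-fixed (λ x → trans (cong (_⟪ renaming-inverse ⟫) (ρ≡f x)) (cong var (f-inj (f∘f⁻¹ (f x))))) t)

  blockSwap : ℕ → ℕ → ℕ
  blockSwap M x with x <? M
  ... | yes _ = M + x
  ... | no _ with x <? M + M
  ...   | yes _ = x ∸ M
  ...   | no _ = x

  blockSwap-low : ∀ {M x} → x < M → blockSwap M x ≡ M + x
  blockSwap-low {M} {x} x<M with x <? M
  ... | yes _ = refl
  ... | no x≮M = ⊥-elim (x≮M x<M)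

  blockSwap-middle : ∀ {M x} → M ≤ x → x < M + M → blockSwap M x ≡ x ∸ M
  blockSwap-middle {M} {x} M≤x x<2M with x <? M
  ... | yes x<M = ⊥-elim (<⇒≱ x<M M≤x)
  ... | no _ with x <? M + M
  ...   | yes _ = refl
  ...   | no x≮2M = ⊥-elim (x≮2M x<2M)

  blockSwap-high : ∀ {M x} → M + M ≤ x → blockSwap M x ≡ x
  blockSwap-high {M} {x} 2M≤x with x <? M
  ... | yes x<M = ⊥-elim (<⇒≱ x<M (≤-trans (m≤m+n M M) 2M≤x))
  ... | no _ with x <? M + M
  ...   | yes x<2M = ⊥-elim (<⇒≱ x<2M 2M≤x)
  ...   | no _ = refl

  blockSwap-involutive : ∀ M x → blockSwap M (blockSwap M x) ≡ x
  blockSwap-involutive M x = by-region (x <? M) (x <? M + M)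
    where
      by-region : Dec (x < M) → Dec (x < M + M) → blockSwap M (blockSwap M x) ≡ x
      by-region (yes x<M) _ =
        trans (cong (blockSwap M) (blockSwap-low {M} x<M))
              (trans (blockSwap-middle {M} (m≤m+n M x) (+-monoʳ-< M x<M)) (m+n∸m≡n M x))
      by-region (no x≮M) (yes x<2M) =
        trans (cong (blockSwap M) (blockSwap-middle {M} M≤x x<2M))
              (trans (blockSwap-low {M} x∸M<M) (m+[n∸m]≡n M≤x))
        where
          M≤x = ≮⇒≥ x≮M
          x∸M<M : x ∸ M < M
          x∸M<M = +-cancelˡ-< M (x ∸ M) M (subst (_< M + M) (sym (m+[n∸m]≡n M≤x)) x<2M)
      by-region (no _) (no x≮2M) =
        trans (cong (blockSwap M) (blockSwap-high {M} (≮⇒≥ x≮2M))) (blockSwap-high {M} (≮⇒≥ x≮2M))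

  blockSwapS : ℕ → Subst
  blockSwapS M = substBelow (λ x → var (blockSwap M x)) (M + M) (λ x 2M≤x → cong var (blockSwap-high {M} 2M≤x))

  blockSwapS-renaming : ∀ M → IsRenaming (blockSwapS M)
  blockSwapS-renaming M =
    blockSwap M , (λ x → refl) ,
    (λ e → trans (sym (blockSwap-involutive M _)) (trans (cong (blockSwap M) e) (blockSwap-involutive M _))) ,
    λ y → blockSwap M y , λ e → trans (cong (blockSwap M) e) (blockSwap-involutive M y)

  -- Most general unifiers, by the Martelli–Montanari rules

  TEqns : Set
  TEqns = List (Term × Term)

  UnifiesT : Subst → TEqns → Set
  UnifiesT δ E = All (λ e → proj₁ e ⟪ δ ⟫ ≡ proj₂ e ⟪ δ ⟫) E

  EqnsBelow : ℕ → TEqns → Set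
  EqnsBelow K E = All (λ e → VarsBelow K (proj₁ e) × VarsBelow K (proj₂ e)) E

  IsMGUT : Subst → TEqns → Set
  IsMGUT θ E = UnifiesT θ E × (∀ δ → UnifiesT δ E → Σ Subst λ γ → ∀ x → app δ x ≡ app θ x ⟪ γ ⟫)

  BoundedMGU : TEqns → Set
  BoundedMGU E = Σ Subst λ θ → IsMGUT θ E × (∀ K → EqnsBelow K E → ∀ y → y < K → VarsBelow K (app θ y))

  mutual
    size : Term → ℕ
    size (var x) = 1
    size (fn f ts) = suc (sizes ts)

    sizes : ∀ {n} → Vec Term n → ℕ
    sizes [] = 0
    sizes (t ∷ ts) = size t + sizes ts

  size-positive : ∀ t → 1 ≤ size t
  size-positive (var x) = s≤s z≤n
  size-positive (fn f ts) = s≤s z≤n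

  mutual
    size-∈v : ∀ {x} (t : Term) δ → x ∈v t → size (app δ x) ≤ size (t ⟪ δ ⟫)
    size-∈v (var y) δ refl = ≤-refl
    size-∈v (fn f ts) δ o = m≤n⇒m≤1+n (sizes-∈v ts δ o)

    sizes-∈v : ∀ {x n} (ts : Vec Term n) δ → x ∈vs ts → size (app δ x) ≤ sizes (ts ⟪ δ ⟫s)
    sizes-∈v (t ∷ ts) δ (inj₁ o) = ≤-trans (size-∈v t δ o) (m≤m+n _ _)
    sizes-∈v (t ∷ ts) δ (inj₂ o) = ≤-trans (sizes-∈v ts δ o) (m≤n+m _ _)

  eqnsSize : Subst → TEqns → ℕ
  eqnsSize δ [] = 0
  eqnsSize δ ((a , b) ∷ E) = size (a ⟪ δ ⟫) + size (b ⟪ δ ⟫) + eqnsSize δ E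

  eqnsSize-++ : ∀ δ E F → eqnsSize δ (E ++ F) ≡ eqnsSize δ E + eqnsSize δ F
  eqnsSize-++ δ [] F = refl
  eqnsSize-++ δ ((a , b) ∷ E) F =
    trans (cong (_+_ (size (a ⟪ δ ⟫) + size (b ⟪ δ ⟫))) (eqnsSize-++ δ E F))
          (sym (+-assoc (size (a ⟪ δ ⟫) + size (b ⟪ δ ⟫)) (eqnsSize δ E) (eqnsSize δ F)))

  eqnsSize-cong : ∀ {σ τ} E → σ ≗ₛ τ → eqnsSize σ E ≡ eqnsSize τ E
  eqnsSize-cong [] h = refl
  eqnsSize-cong ((a , b) ∷ E) h =
    cong₂ _+_ (cong₂ _+_ (cong size (sub-cong h a)) (cong size (sub-cong h b))) (eqnsSize-cong E h)

  zipEqns : ∀ {n} → Vec Term n → Vec Term n → TEqns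
  zipEqns [] [] = []
  zipEqns (t ∷ ts) (u ∷ us) = (t , u) ∷ zipEqns ts us

  eqnsSize-zipEqns : ∀ {n} δ (ts us : Vec Term n) →
                     eqnsSize δ (zipEqns ts us) ≡ sizes (ts ⟪ δ ⟫s) + sizes (us ⟪ δ ⟫s)
  eqnsSize-zipEqns δ [] [] = refl
  eqnsSize-zipEqns δ (t ∷ ts) (u ∷ us) =
    trans (cong (_+_ (size (t ⟪ δ ⟫) + size (u ⟪ δ ⟫))) (eqnsSize-zipEqns δ ts us))
          (ℕSolver.+-*-Solver.solve 4 (λ a b c d → a :+ b :+ (c :+ d) := a :+ c :+ (b :+ d)) refl
             (size (t ⟪ δ ⟫)) (size (u ⟪ δ ⟫)) (sizes (ts ⟪ δ ⟫s)) (sizes (us ⟪ δ ⟫s)))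
    where open ℕSolver.+-*-Solver using (_:+_; _:=_)

  zipEqns-unifies⁻ : ∀ {n} δ (ts us : Vec Term n) → UnifiesT δ (zipEqns ts us) → ts ⟪ δ ⟫s ≡ us ⟪ δ ⟫s
  zipEqns-unifies⁻ δ [] [] [] = refl
  zipEqns-unifies⁻ δ (t ∷ ts) (u ∷ us) (e ∷ es) = cong₂ _∷_ e (zipEqns-unifies⁻ δ ts us es)

  zipEqns-unifies⁺ : ∀ {n} δ (ts us : Vec Term n) → ts ⟪ δ ⟫s ≡ us ⟪ δ ⟫s → UnifiesT δ (zipEqns ts us)
  zipEqns-unifies⁺ δ [] [] e = []
  zipEqns-unifies⁺ δ (t ∷ ts) (u ∷ us) e = cong Vec.head e ∷ zipEqns-unifies⁺ δ ts us (cong Vec.tail e)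

  zipEqns-below : ∀ {n K} (ts us : Vec Term n) → (∀ x → x ∈vs ts → x < K) → (∀ x → x ∈vs us → x < K) →
                  EqnsBelow K (zipEqns ts us)
  zipEqns-below [] [] _ _ = []
  zipEqns-below (t ∷ ts) (u ∷ us) bt bu =
    ((λ x o → bt x (inj₁ o)) , (λ x o → bu x (inj₁ o))) ∷
    zipEqns-below ts us (λ x o → bt x (inj₂ o)) (λ x o → bu x (inj₂ o))

  infix 6 _↦_
  _↦_ : ℕ → Term → Subst
  x ↦ t = mkSubst bind ([ x ] , fixed)
    where
      bind : ℕ → Term
      bind y with y ≟ x
      ... | yes _ = t
      ... | no _ = var y
      fixed : ∀ y → y ∉ [ x ] → bind y ≡ var y
      fixed y y∉ with y ≟ x
      ... | yes y≡x = ⊥-elim (y∉ (here y≡x))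
      ... | no _ = refl

  ↦-hit : ∀ x t → app (x ↦ t) x ≡ t
  ↦-hit x t with x ≟ x
  ... | yes _ = refl
  ... | no x≢x = ⊥-elim (x≢x refl)

  ↦-miss : ∀ {x y} t → y ≢ x → app (x ↦ t) y ≡ var y
  ↦-miss {x} {y} t y≢x with y ≟ x
  ... | yes y≡x = ⊥-elim (y≢x y≡x)
  ... | no _ = refl

  ↦-not-occurring : ∀ x t → ¬ (x ∈v t) → t ⟪ x ↦ t ⟫ ≡ t
  ↦-not-occurring x t x∉t =
    trans (sub-local {x ↦ t} {idS} t (λ y o → ↦-miss t (λ y≡x → x∉t (subst (_∈v t) y≡x o)))) (sub-id t)

  ↦-absorbed : ∀ x t δ → app δ x ≡ t ⟪ δ ⟫ → ((x ↦ t) ∘ₛ δ) ≗ₛ δ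
  ↦-absorbed x t δ e y with y ≟ x
  ... | yes refl = sym e
  ... | no _ = refl

  subEqns : TEqns → Subst → TEqns
  subEqns E σ = List.map (λ e → proj₁ e ⟪ σ ⟫ , proj₂ e ⟪ σ ⟫) E

  subEqns-unifies⁻ : ∀ E σ δ → UnifiesT δ (subEqns E σ) → UnifiesT (σ ∘ₛ δ) E
  subEqns-unifies⁻ [] σ δ [] = []
  subEqns-unifies⁻ ((a , b) ∷ E) σ δ (e ∷ es) =
    trans (sub-∘ a σ δ) (trans e (sym (sub-∘ b σ δ))) ∷ subEqns-unifies⁻ E σ δ es

  subEqns-unifies⁺ : ∀ E σ δ → UnifiesT (σ ∘ₛ δ) E → UnifiesT δ (subEqns E σ)
  subEqns-unifies⁺ [] σ δ [] = []
  subEqns-unifies⁺ ((a , b) ∷ E) σ δ (e ∷ es) =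
    trans (sym (sub-∘ a σ δ)) (trans e (sub-∘ b σ δ)) ∷ subEqns-unifies⁺ E σ δ es

  unifies-cong : ∀ {σ τ} E → σ ≗ₛ τ → UnifiesT σ E → UnifiesT τ E
  unifies-cong [] h [] = []
  unifies-cong ((a , b) ∷ E) h (e ∷ es) = trans (sym (sub-cong h a)) (trans e (sub-cong h b)) ∷ unifies-cong E h es

  eqnsSize-subEqns : ∀ E σ δ → eqnsSize δ (subEqns E σ) ≡ eqnsSize (σ ∘ₛ δ) E
  eqnsSize-subEqns [] σ δ = refl
  eqnsSize-subEqns ((a , b) ∷ E) σ δ =
    cong₂ _+_ (cong₂ _+_ (cong size (sym (sub-∘ a σ δ))) (cong size (sym (sub-∘ b σ δ)))) (eqnsSize-subEqns E σ δ)

  subEqns-below : ∀ {K} E σ → EqnsBelow K E → (∀ y → y < K → VarsBelow K (app σ y)) → EqnsBelow K (subEqns E σ)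
  subEqns-below [] σ [] h = []
  subEqns-below ((a , b) ∷ E) σ ((ba , bb) ∷ bs) h =
    (VarsBelow-sub σ a ba h , VarsBelow-sub σ b bb h) ∷ subEqns-below E σ bs h

  bmgu-delete : ∀ t E → BoundedMGU E → BoundedMGU ((t , t) ∷ E)
  bmgu-delete t E (θ , (unif , mg) , bd) =
    θ , (refl ∷ unif , λ δ us → mg δ (All.tail us)) , λ K bs → bd K (All.tail bs)

  bmgu-swap : ∀ a b E → BoundedMGU ((a , b) ∷ E) → BoundedMGU ((b , a) ∷ E)
  bmgu-swap a b E (θ , (e ∷ unif , mg) , bd) =
    θ , (sym e ∷ unif , λ δ us → mg δ (sym (All.head us) ∷ All.tail us)) ,
    λ K bs → bd K (swap (All.head bs) ∷ All.tail bs)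

  bmgu-decompose : ∀ f (ts us : Vec Term (arity f)) E →
                   BoundedMGU (zipEqns ts us ++ E) → BoundedMGU ((fn f ts , fn f us) ∷ E)
  bmgu-decompose f ts us E (θ , (unif , mg) , bd) =
    θ ,
    (cong (fn f) (zipEqns-unifies⁻ θ ts us (AllP.++⁻ˡ (zipEqns ts us) unif)) ∷ AllP.++⁻ʳ (zipEqns ts us) unif ,
     λ δ es → mg δ (AllP.++⁺ (zipEqns-unifies⁺ δ ts us (fn-injectiveʳ (All.head es))) (All.tail es))) ,
    λ K bs → bd K (AllP.++⁺ (zipEqns-below ts us (proj₁ (All.head bs)) (proj₂ (All.head bs))) (All.tail bs))

  bmgu-eliminate : ∀ x t E → ¬ (x ∈v t) → BoundedMGU (subEqns E (x ↦ t)) → BoundedMGU ((var x , t) ∷ E)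
  bmgu-eliminate x t E x∉t (θ , (unif , mg) , bd) = (x ↦ t) ∘ₛ θ , (solves ∷ subEqns-unifies⁻ E (x ↦ t) θ unif , general) , below
    where
      solves : app (x ↦ t) x ⟪ θ ⟫ ≡ t ⟪ (x ↦ t) ∘ₛ θ ⟫
      solves = begin
        app (x ↦ t) x ⟪ θ ⟫   ≡⟨ cong (_⟪ θ ⟫) (trans (↦-hit x t) (sym (↦-not-occurring x t x∉t))) ⟩
        t ⟪ x ↦ t ⟫ ⟪ θ ⟫     ≡⟨ sym (sub-∘ t (x ↦ t) θ) ⟩
        t ⟪ (x ↦ t) ∘ₛ θ ⟫    ∎
        where open ≡-Reasoning
      general : ∀ δ → UnifiesT δ ((var x , t) ∷ E) → Σ Subst λ γ → ∀ y → app δ y ≡ app ((x ↦ t) ∘ₛ θ) y ⟪ γ ⟫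
      general δ (e ∷ es) with mg δ (subEqns-unifies⁺ E (x ↦ t) δ (unifies-cong E (λ y → sym (↦-absorbed x t δ e y)) es))
      ... | γ , δ≡θγ = γ , λ y → trans (sym (↦-absorbed x t δ e y))
                                   (trans (sub-cong {δ} {θ ∘ₛ γ} δ≡θγ (app (x ↦ t) y)) (sub-∘ (app (x ↦ t) y) θ γ))
      below : ∀ K → EqnsBelow K ((var x , t) ∷ E) → ∀ y → y < K → VarsBelow K (app ((x ↦ t) ∘ₛ θ) y)
      below K ((_ , bt) ∷ bs) y y<K = VarsBelow-sub θ (app (x ↦ t) y) (↦-below y y<K) (bd K (subEqns-below E (x ↦ t) bs ↦-below))
        where
          ↦-below : ∀ z → z < K → VarsBelow K (app (x ↦ t) z)
          ↦-below z z<K with z ≟ x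
          ... | yes _ = bt
          ... | no _ = VarsBelow-var z<K

  ↦-decreases : ∀ x t E δ → app δ x ≡ t ⟪ δ ⟫ →
                eqnsSize δ (subEqns E (x ↦ t)) < size (app δ x) + size (t ⟪ δ ⟫) + eqnsSize δ E
  ↦-decreases x t E δ e =
    subst (_< size (app δ x) + size (t ⟪ δ ⟫) + eqnsSize δ E)
          (sym (trans (eqnsSize-subEqns E (x ↦ t) δ) (eqnsSize-cong E (↦-absorbed x t δ e))))
          (m<n+m (eqnsSize δ E) (≤-trans (size-positive (app δ x)) (m≤m+n _ _)))

  -- Recursion on a fuel bounding the size of the equations under a known unifier δ; the
  -- Martelli–Montanari rules all decrease that size.
  mutual
    unify : ∀ (fuel : ℕ) (E : TEqns) (δ : Subst) → UnifiesT δ E → eqnsSize δ E < fuel → BoundedMGU E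
    unify (suc n) [] δ _ _ =
      idS , ([] , λ δ′ _ → δ′ , λ x → refl) , λ K _ y y<K → VarsBelow-var y<K
    unify (suc n) ((var x , t) ∷ E) δ (e ∷ unif) lt = unify-var n δ x t E e unif lt
    unify (suc n) ((fn f ts , var x) ∷ E) δ (e ∷ unif) lt =
      bmgu-swap (var x) (fn f ts) E (unify-var n δ x (fn f ts) E (sym e) unif
        (subst (λ z → z + eqnsSize δ E < suc n) (+-comm (size (fn f ts ⟪ δ ⟫)) (size (app δ x))) lt))
    unify (suc n) ((fn f ts , fn g us) ∷ E) δ (e ∷ unif) lt with fn-injectiveˡ e
    ... | refl = bmgu-decompose f ts us E
                   (unify n (zipEqns ts us ++ E) δ (AllP.++⁺ (zipEqns-unifies⁺ δ ts us (fn-injectiveʳ e)) unif)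
                      (≤-trans decreases (≤-pred lt)))
      where
        decreases : eqnsSize δ (zipEqns ts us ++ E) < suc (sizes (ts ⟪ δ ⟫s)) + suc (sizes (us ⟪ δ ⟫s)) + eqnsSize δ E
        decreases rewrite eqnsSize-++ δ (zipEqns ts us) E | eqnsSize-zipEqns δ ts us =
          +-monoˡ-< (eqnsSize δ E) (+-mono-< (n<1+n (sizes (ts ⟪ δ ⟫s))) (n<1+n (sizes (us ⟪ δ ⟫s))))

    unify-var : ∀ n δ x t E → app δ x ≡ t ⟪ δ ⟫ → UnifiesT δ E →
                size (app δ x) + size (t ⟪ δ ⟫) + eqnsSize δ E < suc n → BoundedMGU ((var x , t) ∷ E)
    unify-var n δ x t E e unif lt with x ∈v? t
    unify-var n δ x (var y) E e unif lt | yes refl =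
      bmgu-delete (var x) E (unify n E δ unif (≤-trans (m<n+m (eqnsSize δ E) (≤-trans (size-positive (app δ x)) (m≤m+n _ _))) (≤-pred lt)))
    unify-var n δ x (fn f ts) E e unif lt | yes x∈t =
      ⊥-elim (<-irrefl refl (subst (size (app δ x) <_) (sym (cong size e)) (s≤s (sizes-∈v ts δ x∈t))))
    unify-var n δ x t E e unif lt | no x∉t =
      bmgu-eliminate x t E x∉t
        (unify n (subEqns E (x ↦ t)) δ
           (subEqns-unifies⁺ E (x ↦ t) δ (unifies-cong E (λ z → sym (↦-absorbed x t δ e z)) unif))
           (≤-trans (↦-decreases x t E δ e) (≤-pred lt)))

  mgu-of-unifiable : ∀ (a b : Term) δ → a ⟪ δ ⟫ ≡ b ⟪ δ ⟫ → BoundedMGU [ (a , b) ]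
  mgu-of-unifiable a b δ e = unify (suc (eqnsSize δ [ (a , b) ])) [ (a , b) ] δ (e ∷ []) ≤-refl

  Flat : Term → Set
  Flat t = Σ Sym λ f → Σ (Vec ℕ (arity f)) λ xs → t ≡ fn f (Vec.map var xs)

  matcher : ∀ {n} → Vec ℕ n → Vec Term n → Subst
  matcher xs ts = mkSubst (match xs ts) (Vec.toList xs , fixed xs ts)
    where
      match : ∀ {n} → Vec ℕ n → Vec Term n → ℕ → Term
      match [] [] y = var y
      match (x ∷ xs) (t ∷ ts) y with y ≟ x
      ... | yes _ = t
      ... | no _ = match xs ts y
      fixed : ∀ {n} (xs : Vec ℕ n) ts y → y ∉ Vec.toList xs → match xs ts y ≡ var y
      fixed [] [] y y∉ = refl
      fixed (x ∷ xs) (t ∷ ts) y y∉ with y ≟ x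
      ... | yes y≡x = ⊥-elim (y∉ (here y≡x))
      ... | no _ = fixed xs ts y (λ o → y∉ (there o))

  Distinct-tail : ∀ {n x} {xs : Vec ℕ n} → Distinct (x ∷ xs) → Distinct xs
  Distinct-tail d i j e = FinP.suc-injective (d (suc i) (suc j) e)

  Distinct-head : ∀ {n x} {xs : Vec ℕ n} → Distinct (x ∷ xs) → ∀ y → y ∈vs Vec.map (var {0}) xs → y ≢ x
  Distinct-head {xs = x′ ∷ xs} d y (inj₁ refl) refl with d zero (suc zero) refl
  ... | ()
  Distinct-head {x = x} {xs = x′ ∷ xs} d y (inj₂ o) = Distinct-head {x = x} {xs = xs} d′ y o
    where
      d′ : Distinct (x ∷ xs)
      d′ zero zero e = refl
      d′ zero (suc j) e with d zero (suc (suc j)) e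
      ... | ()
      d′ (suc i) zero e with d (suc (suc i)) zero e
      ... | ()
      d′ (suc i) (suc j) e = FinP.suc-injective (d (suc (suc i)) (suc (suc j)) e)

  matcher-matches : ∀ {n} (xs : Vec ℕ n) ts → Distinct xs → Vec.map var xs ⟪ matcher xs ts ⟫s ≡ ts
  matcher-matches [] [] d = refl
  matcher-matches (x ∷ xs) (t ∷ ts) d = cong₂ _∷_ head-matches tail-matches
    where
      head-matches : app (matcher (x ∷ xs) (t ∷ ts)) x ≡ t
      head-matches with x ≟ x
      ... | yes _ = refl
      ... | no x≢x = ⊥-elim (x≢x refl)
      tail-agrees : ∀ y → y ∈vs Vec.map var xs → app (matcher (x ∷ xs) (t ∷ ts)) y ≡ app (matcher xs ts) y
      tail-agrees y o with y ≟ x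
      ... | yes y≡x = ⊥-elim (Distinct-head d y o y≡x)
      ... | no _ = refl
      tail-matches : Vec.map var xs ⟪ matcher (x ∷ xs) (t ∷ ts) ⟫s ≡ ts
      tail-matches = trans (subs-local (Vec.map var xs) tail-agrees) (matcher-matches xs ts (Distinct-tail d))

  -- A single unifier of a goal (via δ) and a clause renamed by blockSwapS M (via Ω), when
  -- both have their variables below M.
  joint : ℕ → (δ Ω : Subst) → Subst
  joint M δ Ω = substBelow pick (M + M) fixed
    where
      pick : ℕ → Term
      pick y with y <? M | y <? M + M
      ... | yes _ | _ = app δ y
      ... | no _ | yes _ = app Ω (y ∸ M)
      ... | no _ | no _ = var y
      fixed : ∀ y → M + M ≤ y → pick y ≡ var y
      fixed y 2M≤y with y <? M | y <? M + M
      ... | yes y<M | _ = ⊥-elim (<⇒≱ y<M (≤-trans (m≤m+n M M) 2M≤y))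
      ... | no _ | yes y<2M = ⊥-elim (<⇒≱ y<2M 2M≤y)
      ... | no _ | no _ = refl

  joint-low : ∀ M δ Ω y → y < M → app (joint M δ Ω) y ≡ app δ y
  joint-low M δ Ω y y<M with y <? M
  ... | yes _ = refl
  ... | no y≮M = ⊥-elim (y≮M y<M)

  joint-swapped : ∀ M δ Ω x → x < M → app (blockSwapS M) x ⟪ joint M δ Ω ⟫ ≡ app Ω x
  joint-swapped M δ Ω x x<M = trans (cong (λ y → app (joint M δ Ω) y) (blockSwap-low {M} x<M)) shifted
    where
      shifted : app (joint M δ Ω) (M + x) ≡ app Ω x
      shifted with M + x <? M | M + x <? M + M
      ... | yes M+x<M | _ = ⊥-elim (<⇒≱ M+x<M (m≤m+n M x))
      ... | no _ | yes _ = cong (app Ω) (m+n∸m≡n M x)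
      ... | no _ | no M+x≮2M = ⊥-elim (M+x≮2M (+-monoʳ-< M x<M))

  ∈vR-blockSwap⁻ : ∀ {x} M r → x ∈vR renR (blockSwapS M) r → Σ ℕ λ y → y ∈vR r × x ≡ blockSwap M y
  ∈vR-blockSwap⁻ M (u , vs) (inj₁ o) with ∈v-sub⁻ u (blockSwapS M) o
  ... | y , y∈u , refl = y , inj₁ y∈u , refl
  ∈vR-blockSwap⁻ M (u , vs) (inj₂ o) with ∈vL-sub⁻ vs (blockSwapS M) o
  ... | y , y∈vs , refl = y , inj₂ y∈vs , refl

  IsMGUT⇒IsMGU : ∀ θ a b → IsMGUT θ [ (a , b) ] → IsMGU θ [ (just a , just b) ]
  IsMGUT⇒IsMGU θ a b (e ∷ [] , mg) = cong just e ∷ [] , λ δ us → mg δ (just-injective (All.head us) ∷ [])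

  module _ (P : Program) where

    infix 4 _⇒⁺_ _⇒*_
    _⇒⁺_ : List Term → List Term → Set
    _⇒⁺_ = TransClosure (Step P)

    _⇒*_ : List Term → List Term → Set
    _⇒*_ = Star (Step P)

    ⇒*-prepend : ∀ {a b c} → Step P a b → b ⇒* c → a ⇒⁺ c
    ⇒*-prepend s ε = Plus.[ s ]
    ⇒*-prepend s (s′ ◅ d) = s Plus.∷ ⇒*-prepend s′ d

    ⇒⁺⇒⇒* : ∀ {a b} → a ⇒⁺ b → a ⇒* b
    ⇒⁺⇒⇒* Plus.[ s ] = s ◅ ε
    ⇒⁺⇒⇒* (s Plus.∷ d) = s ◅ ⇒⁺⇒⇒* d

    -- Resolving the goal g ∷ ss with a renamed-apart copy of a clause u ← vs, when Ω unifies u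
    -- with g ⟪ δ ⟫. All variables of the goal are below K.
    record FirstStep (u : Term) (vs : List Term) (g : Term) (ss : List Term) (K : ℕ) (δ Ω : Subst) : Set where
      field
        π γ₀ λ₀ : Subst
        K₁ : ℕ
        K≤K₁ : K ≤ K₁
        step₁ : Step P (g ∷ ss) (mapsub γ₀ (mapsub π vs ++ ss))
        δ≈γ₀λ₀ : ∀ y → y < K → app δ y ≡ app γ₀ y ⟪ λ₀ ⟫
        Ω≈πγ₀λ₀ : ∀ x → x ∈vR (u , vs) → app Ω x ≡ app π x ⟪ γ₀ ⟫ ⟪ λ₀ ⟫
        γ₀-below : ∀ y → y < K₁ → VarsBelow K₁ (app γ₀ y)
        π-below : ∀ x → x ∈vR (u , vs) → VarsBelow K₁ (app π x)
        γ₀-unifies : u ⟪ π ⟫ ⟪ γ₀ ⟫ ≡ g ⟪ γ₀ ⟫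

    resolve-first : ∀ u vs → P (u , vs) → ∀ g ss K → VarsBelow K g → All (VarsBelow K) ss →
                    ∀ δ Ω → u ⟪ Ω ⟫ ≡ g ⟪ δ ⟫ → FirstStep u vs g ss K δ Ω
    resolve-first u vs u←vs∈P g ss K g<K ss<K δ Ω uΩ≡gδ = record
      { π = π ; γ₀ = γ₀ ; λ₀ = λ₀ ; K₁ = M + M ; K≤K₁ = K≤2M
      ; step₁ = step (u , vs) u←vs∈P (u ⟪ π ⟫) (mapsub π vs) apart γ₀ (IsMGUT⇒IsMGU γ₀ (u ⟪ π ⟫) g mgu)
      ; δ≈γ₀λ₀ = λ y y<K → trans (sym (joint-low M δ Ω y (≤-trans y<K (m≤m⊔n K L)))) (κ≈γ₀λ₀ y)
      ; Ω≈πγ₀λ₀ = λ x o → trans (sym (joint-swapped M δ Ω x (rule<M o))) (κ≈γ₀λ₀ (blockSwap M x))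
      ; γ₀-below = γ₀-bounded (M + M) ((π-below-u , VarsBelow-mono K≤2M g g<K) ∷ [])
      ; π-below = λ x o → VarsBelow-var (swapped<2M (rule<M o))
      ; γ₀-unifies = All.head (proj₁ mgu) }
      where
        L = varBoundR (u , vs)
        M = K ⊔ L
        π = blockSwapS M
        κ = joint M δ Ω
        K≤2M : K ≤ M + M
        K≤2M = ≤-trans (m≤m⊔n K L) (m≤m+n M M)
        rule<M : ∀ {x} → x ∈vR (u , vs) → x < M
        rule<M o = ≤-trans (varBoundR-correct (u , vs) _ o) (m≤n⊔m K L)
        swapped<2M : ∀ {x} → x < M → blockSwap M x < M + M
        swapped<2M {x} x<M = subst (_< M + M) (sym (blockSwap-low {M} x<M)) (+-monoʳ-< M x<M)
        uπκ≡gκ : u ⟪ π ⟫ ⟪ κ ⟫ ≡ g ⟪ κ ⟫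
        uπκ≡gκ = begin
          u ⟪ π ⟫ ⟪ κ ⟫  ≡⟨ sym (sub-∘ u π κ) ⟩
          u ⟪ π ∘ₛ κ ⟫   ≡⟨ sub-local u (λ x o → joint-swapped M δ Ω x (rule<M (inj₁ o))) ⟩
          u ⟪ Ω ⟫        ≡⟨ uΩ≡gδ ⟩
          g ⟪ δ ⟫        ≡⟨ sym (sub-local g (λ x o → joint-low M δ Ω x (≤-trans (g<K x o) (m≤m⊔n K L)))) ⟩
          g ⟪ κ ⟫        ∎
          where open ≡-Reasoning
        bmgu = mgu-of-unifiable (u ⟪ π ⟫) g κ uπκ≡gκ
        γ₀ = proj₁ bmgu
        mgu = proj₁ (proj₂ bmgu)
        γ₀-bounded = proj₂ (proj₂ bmgu)
        λ₀ = proj₁ (proj₂ mgu κ (uπκ≡gκ ∷ []))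
        κ≈γ₀λ₀ = proj₂ (proj₂ mgu κ (uπκ≡gκ ∷ []))
        π-below-u : VarsBelow (M + M) (u ⟪ π ⟫)
        π-below-u z o with ∈v-sub⁻ u π o
        ... | y , y∈u , refl = swapped<2M (rule<M (inj₁ y∈u))
        goal<K : ∀ {z} → Any (z ∈v_) (g ∷ ss) → z < K
        goal<K (here o) = g<K _ o
        goal<K (there o) = AnyVarsBelow ss<K o
        apart : Apart _∈vR_ (λ x → Any (x ∈v_) (g ∷ ss)) [ (u ⟪ π ⟫ , mapsub π vs) ] (VariantR (u , vs))
        apart = ((π , blockSwapS-renaming M , refl) ∷ []) , (disjoint ∷ []) , ([] ∷ [])
          where
            disjoint : ∀ x → x ∈vR (u ⟪ π ⟫ , mapsub π vs) → Any (x ∈v_) (g ∷ ss) → ⊥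
            disjoint x o o′ with ∈vR-blockSwap⁻ M (u , vs) o
            ... | y , y∈r , refl =
              <⇒≱ (goal<K o′) (≤-trans (m≤m⊔n K L) (subst (M ≤_) (sym (blockSwap-low {M} (rule<M y∈r))) (m≤m+n M y)))

    -- Soundness of binunf with respect to calls

    level : ℕ → Pred BinRule 0ℓ
    level = iter (Tβ P)

    -- A run solving the atom g in front of ss, as predicted by the fact u.  Its answer ψ is
    -- more general than δ on the goal variables (those below K), so the rest of the goal keeps
    -- its instance.
    record FactRun (u : TermE) (g : Term) (ss : List Term) (K : ℕ) (δ : Subst) : Set where
      field
        ψ λ′ : Subst
        K′ : ℕ
        δ≈ψλ′ : ∀ y → y < K → app δ y ≡ app ψ y ⟪ λ′ ⟫
        ψ-below : ∀ y → y < K → VarsBelow K′ (app ψ y)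
        η : Subst
        uη≡gψ : u ⟪ η ⟫ₑ ≡ just (g ⟪ ψ ⟫)
        run : g ∷ ss ⇒⁺ mapsub ψ ss

    -- A derivation from g ∷ ss reaching the call t, as predicted by the rule u → v.  The
    -- identity rules can only predict v up to an instance τ of the call; then t ⟪ τ ⟫ is flat.
    record CallRun (u : TermE) (v : Term) (g : Term) (ss : List Term) : Set where
      field
        ψ τ η : Subst
        uη≡gψτ : u ⟪ η ⟫ₑ ≡ just (g ⟪ ψ ⟫ ⟪ τ ⟫)
        t : Term
        rest : List Term
        run : g ∷ ss ⇒⁺ t ∷ rest
        vη≡tτ : v ⟪ η ⟫ ≡ t ⟪ τ ⟫
        τ-trivial-or-flat : (∀ y → app τ y ≡ var y) ⊎ Flat (t ⟪ τ ⟫)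

    Run : BinRule → Term → List Term → ℕ → Subst → Set
    Run (u , nothing) g ss K δ = FactRun u g ss K δ
    Run (u , just v) g ss K δ = CallRun u v g ss

    LevelSound : ℕ → Set
    LevelSound N = ∀ b → level N b → ∀ g ss K → VarsBelow K g → All (VarsBelow K) ss → ∀ δ Θ →
                   proj₁ b ⟪ Θ ⟫ₑ ≡ just (g ⟪ δ ⟫) → Run b g ss K δ

    Solved : Subst → List TermE → List Term → Set
    Solved ψ = Pointwise (λ p a → Σ Subst λ η → p ⟪ η ⟫ₑ ≡ just (a ⟪ ψ ⟫))

    record FactsRun (pre : List TermE) (as R : List Term) (K : ℕ) (λc : Subst) : Set where
      field
        ψ λ′ : Subst
        K′ : ℕ
        run : as ++ R ⇒* mapsub ψ R
        λc≈ψλ′ : ∀ y → y < K → app λc y ≡ app ψ y ⟪ λ′ ⟫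
        ψ-below : ∀ y → y < K → VarsBelow K′ (app ψ y)
        solved : Solved ψ pre as

    factor-∘ : ∀ {K′} (λ₀ ψ λ₁ ψ′ λ₂ : Subst) y → app λ₀ y ≡ app ψ y ⟪ λ₁ ⟫ → VarsBelow K′ (app ψ y) →
               (∀ z → z < K′ → app λ₁ z ≡ app ψ′ z ⟪ λ₂ ⟫) → app λ₀ y ≡ app (ψ ∘ₛ ψ′) y ⟪ λ₂ ⟫
    factor-∘ λ₀ ψ λ₁ ψ′ λ₂ y e b h =
      trans e (trans (sub-local {λ₁} {ψ′ ∘ₛ λ₂} (app ψ y) (λ z o → h z (b z o))) (sub-∘ (app ψ y) ψ′ λ₂))

    run-facts : ∀ {N} → LevelSound N → ∀ (Ω : Subst) pre (as R : List Term) (λc : Subst) K →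
                All (λ p → level N (p , nothing)) pre →
                Pointwise (λ p a → p ⟪ Ω ⟫ₑ ≡ just (a ⟪ λc ⟫)) pre as →
                All (VarsBelow K) (as ++ R) → FactsRun pre as R K λc
    run-facts IH Ω [] [] R λc K [] [] _ = record
      { ψ = idS ; λ′ = λc ; K′ = K
      ; run = subst (R ⇒*_) (sym (mapsub-id R)) ε
      ; λc≈ψλ′ = λ y _ → refl
      ; ψ-below = λ y y<K → VarsBelow-var y<K
      ; solved = [] }
    run-facts {N} IH Ω (p ∷ pre) (a ∷ as) R λc K (p∈ ∷ ps∈) (pΩ ∷ psΩ) (a<K ∷ as++R<K) = record
      { ψ = ψ₁ ∘ₛ ψ
      ; λ′ = λ′
      ; K′ = K′
      ; run = subst (a ∷ as ++ R ⇒*_) (mapsub-∘ ψ₁ ψ R)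
                (⇒⁺⇒⇒* run₁ ◅◅ subst (_⇒* mapsub ψ (mapsub ψ₁ R)) (sym (map-++ (_⟪ ψ₁ ⟫) as R)) run)
      ; λc≈ψλ′ = λ y y<K → factor-∘ λc ψ₁ λ₁ ψ λ′ y (δ≈ψλ₁ y y<K) (ψ₁-below y y<K) λc≈ψλ′
      ; ψ-below = λ y y<K → VarsBelow-sub ψ (app ψ₁ y) (ψ₁-below y y<K) ψ-below
      ; solved = (η₁ ∘ₛ ψ , trans (sub-∘ₑ p η₁ ψ) (trans (cong (_⟪ ψ ⟫ₑ) pη≡aψ₁) (cong just (sym (sub-∘ a ψ₁ ψ)))))
                 ∷ unshift solved }
      where
        first = IH (p , nothing) p∈ a (as ++ R) K a<K as++R<K λc Ω pΩ
        open FactRun first renaming (ψ to ψ₁; λ′ to λ₁; K′ to K₁; δ≈ψλ′ to δ≈ψλ₁; ψ-below to ψ₁-below;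
                                     η to η₁; uη≡gψ to pη≡aψ₁; run to run₁)
        psΩ′ : ∀ {pre′} as′ → All (VarsBelow K) as′ → Pointwise (λ p a → p ⟪ Ω ⟫ₑ ≡ just (a ⟪ λc ⟫)) pre′ as′ →
               Pointwise (λ p a → p ⟪ Ω ⟫ₑ ≡ just (a ⟪ λ₁ ⟫)) pre′ (mapsub ψ₁ as′)
        psΩ′ [] [] [] = []
        psΩ′ (a′ ∷ as′) (b′ ∷ bs′) (e ∷ es) =
          trans e (cong just (trans (sub-local {λc} {ψ₁ ∘ₛ λ₁} a′ (λ z o → δ≈ψλ₁ z (b′ z o))) (sub-∘ a′ ψ₁ λ₁)))
          ∷ psΩ′ as′ bs′ es
        rest : FactsRun pre (mapsub ψ₁ as) (mapsub ψ₁ R) K₁ λ₁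
        rest = run-facts {N} IH Ω pre (mapsub ψ₁ as) (mapsub ψ₁ R) λ₁ K₁ ps∈
                 (psΩ′ as (proj₁ (AllP.++⁻ as as++R<K)) psΩ)
                 (subst (All (VarsBelow K₁)) (map-++ _ as R) (VarsBelow-mapsub ψ₁ (as ++ R) as++R<K ψ₁-below))
        open FactsRun rest
        unshift : ∀ {pre′ as′} → Solved ψ pre′ (mapsub ψ₁ as′) → Solved (ψ₁ ∘ₛ ψ) pre′ as′
        unshift {[]} {[]} [] = []
        unshift {_ ∷ _} {a′ ∷ _} ((η , e) ∷ r) = (η , trans e (cong just (sym (sub-∘ a′ ψ₁ ψ)))) ∷ unshift r

    -- Since the clause, the facts and the last rule are variable disjoint, their separate
    -- solutions glue into a single substitution.
    module Glue (u : Term) (vs : List Term) (π γ₀ ψ Φ ηℓ : Subst) (uℓ v : TermE)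
                {pre : List TermE} {as : List Term} (solved : Solved ψ pre as) where

      rulesOf : List TermE → List BinRule
      rulesOf pre′ = List.map (λ p → (p , nothing)) pre′ ++ [ (uℓ , v) ]

      factsPart : ∀ {pre′ as′} → Solved ψ pre′ as′ → ℕ → Term
      factsPart [] x with x ∈vB? (uℓ , v)
      ... | yes _ = app ηℓ x
      ... | no _ = var x
      factsPart (_∷_ {x = p} (η , _) sol) x with x ∈vE? p
      ... | yes _ = app η x ⟪ Φ ⟫
      ... | no _ = factsPart sol x

      factsPart-fixed : ∀ {pre′ as′} (sol : Solved ψ pre′ as′) x → varBoundBs (rulesOf pre′) ≤ x → factsPart sol x ≡ var x
      factsPart-fixed [] x B≤x with x ∈vB? (uℓ , v)
      ... | yes o = ⊥-elim (<⇒≱ (varBoundB-correct (uℓ , v) x o) (≤-trans (m≤m⊔n _ _) B≤x))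
      ... | no _ = refl
      factsPart-fixed (_∷_ {x = p} (η , _) sol) x B≤x with x ∈vE? p
      ... | yes o = ⊥-elim (<⇒≱ (varBoundE-correct p x o) (≤-trans (m≤m⊔n (varBoundE p) 0) (≤-trans (m≤m⊔n _ _) B≤x)))
      ... | no _ = factsPart-fixed sol x (≤-trans (m≤n⊔m _ _) B≤x)

      gluedAt : ℕ → Term
      gluedAt x with x ∈vR? (u , vs)
      ... | yes _ = app π x ⟪ γ₀ ⟫ ⟪ ψ ⟫ ⟪ Φ ⟫
      ... | no _ = factsPart solved x

      glued : Subst
      glued = substBelow gluedAt (varBoundR (u , vs) ⊔ varBoundBs (rulesOf pre)) fixed
        where
          fixed : ∀ x → varBoundR (u , vs) ⊔ varBoundBs (rulesOf pre) ≤ x → gluedAt x ≡ var x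
          fixed x B≤x with x ∈vR? (u , vs)
          ... | yes o = ⊥-elim (<⇒≱ (varBoundR-correct (u , vs) x o) (≤-trans (m≤m⊔n _ _) B≤x))
          ... | no _ = factsPart-fixed solved x (≤-trans (m≤n⊔m _ _) B≤x)

      glued-clause : ∀ x → x ∈vR (u , vs) → app glued x ≡ app π x ⟪ γ₀ ⟫ ⟪ ψ ⟫ ⟪ Φ ⟫
      glued-clause x o with x ∈vR? (u , vs)
      ... | yes _ = refl
      ... | no x∉ = ⊥-elim (x∉ o)

      glued-facts : ∀ x → ¬ (x ∈vR (u , vs)) → app glued x ≡ factsPart solved x
      glued-facts x x∉ with x ∈vR? (u , vs)
      ... | yes o = ⊥-elim (x∉ o)
      ... | no _ = refl

      glued-clause-term : ∀ t → (∀ x → x ∈v t → x ∈vR (u , vs)) → t ⟪ glued ⟫ ≡ t ⟪ π ⟫ ⟪ γ₀ ⟫ ⟪ ψ ⟫ ⟪ Φ ⟫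
      glued-clause-term t t⊆ = begin
        t ⟪ glued ⟫                          ≡⟨ sub-local t (λ x o → trans (glued-clause x (t⊆ x o)) (unfold (app π x))) ⟩
        t ⟪ π ∘ₛ (γ₀ ∘ₛ (ψ ∘ₛ Φ)) ⟫          ≡⟨ sub-∘ t π _ ⟩
        t ⟪ π ⟫ ⟪ γ₀ ∘ₛ (ψ ∘ₛ Φ) ⟫           ≡⟨ unfold (t ⟪ π ⟫) ⟨
        t ⟪ π ⟫ ⟪ γ₀ ⟫ ⟪ ψ ⟫ ⟪ Φ ⟫           ∎
        where
          open ≡-Reasoning
          unfold : ∀ s → s ⟪ γ₀ ⟫ ⟪ ψ ⟫ ⟪ Φ ⟫ ≡ s ⟪ γ₀ ∘ₛ (ψ ∘ₛ Φ) ⟫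
          unfold s = sym (trans (sub-∘ s γ₀ (ψ ∘ₛ Φ)) (sub-∘ (s ⟪ γ₀ ⟫) ψ Φ))

      Disjoint : BinRule → BinRule → Set
      Disjoint r r′ = ∀ x → x ∈vB r → x ∈vB r′ → ⊥

      factsPart-here : ∀ {p pre′ a as′} η (e : p ⟪ η ⟫ₑ ≡ just (a ⟪ ψ ⟫)) (sol : Solved ψ pre′ as′) x → x ∈vE p →
                       factsPart (_∷_ {x = p} {y = a} (η , e) sol) x ≡ app η x ⟪ Φ ⟫
      factsPart-here {p} η e sol x o with x ∈vE? p
      ... | yes _ = refl
      ... | no x∉ = ⊥-elim (x∉ o)

      factsPart-there : ∀ {p pre′ a as′} η (e : p ⟪ η ⟫ₑ ≡ just (a ⟪ ψ ⟫)) (sol : Solved ψ pre′ as′) x → ¬ (x ∈vE p) →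
                        factsPart (_∷_ {x = p} {y = a} (η , e) sol) x ≡ factsPart sol x
      factsPart-there {p} η e sol x x∉ with x ∈vE? p
      ... | yes o = ⊥-elim (x∉ o)
      ... | no _ = refl

      factsPart-last : ∀ {pre′ as′} (sol : Solved ψ pre′ as′) → AllPairs Disjoint (rulesOf pre′) →
                       ∀ x → x ∈vB (uℓ , v) → factsPart sol x ≡ app ηℓ x
      factsPart-last [] _ x o with x ∈vB? (uℓ , v)
      ... | yes _ = refl
      ... | no x∉ = ⊥-elim (x∉ o)
      factsPart-last {p ∷ pre′} {a ∷ _} ((η , e) ∷ sol) (d ∷ ds) x o =
        trans (factsPart-there {a = a} η e sol x (λ o′ → All.head (AllP.++⁻ʳ (List.map _ pre′) d) x (inj₁ o′) o))
              (factsPart-last sol ds x o)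

      SolvesFacts : ∀ {pre′ as′} → Solved ψ pre′ as′ → List TermE → List Term → Set
      SolvesFacts sol = Pointwise (λ p a → ∀ σ → (∀ x → x ∈vE p → app σ x ≡ factsPart sol x) →
                                           p ⟪ σ ⟫ₑ ≡ just (a ⟪ ψ ⟫ ⟪ Φ ⟫))

      factsPart-solves : ∀ {pre′ as′} (sol : Solved ψ pre′ as′) → AllPairs Disjoint (rulesOf pre′) →
                         SolvesFacts sol pre′ as′
      factsPart-solves [] _ = []
      factsPart-solves {p ∷ pre′} {a ∷ as′} ((η , e) ∷ sol) (d ∷ ds) =
        (λ σ agree → trans (sub-localₑ {σ} {η ∘ₛ Φ} p (λ x o → trans (agree x o) (factsPart-here {a = a} η e sol x o)))
                          (trans (sub-∘ₑ p η Φ) (cong (_⟪ Φ ⟫ₑ) e)))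
        ∷ skip (AllP.map⁻ (AllP.++⁻ˡ (List.map _ pre′) d)) (factsPart-solves sol ds)
        where
          skip : ∀ {pre″ as″} → All (λ p′ → Disjoint (p , nothing) (p′ , nothing)) pre″ →
                 SolvesFacts sol pre″ as″ → SolvesFacts (_∷_ {x = p} {y = a} (η , e) sol) pre″ as″
          skip [] [] = []
          skip (d′ ∷ ds′) (k ∷ ks) =
            (λ σ agree → k σ (λ x o → trans (agree x o) (factsPart-there {a = a} η e sol x (λ o′ → d′ x (inj₁ o′) (inj₁ o)))))
            ∷ skip ds′ ks

    pointwise-unifies⁻ : ∀ σ (pre : List TermE) ws → length pre ≡ length ws → Unifies σ (zip pre (List.map just ws)) →
                         Pointwise (λ p w → p ⟪ σ ⟫ₑ ≡ just (w ⟪ σ ⟫)) pre ws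
    pointwise-unifies⁻ σ [] [] _ _ = []
    pointwise-unifies⁻ σ (p ∷ pre) (w ∷ ws) l (e ∷ es) = e ∷ pointwise-unifies⁻ σ pre ws (suc-injective l) es

    pointwise-unifies⁺ : ∀ σ (pre : List TermE) ws → Pointwise (λ p w → p ⟪ σ ⟫ₑ ≡ just (w ⟪ σ ⟫)) pre ws →
                         Unifies σ (zip pre (List.map just ws))
    pointwise-unifies⁺ σ [] [] [] = []
    pointwise-unifies⁺ σ (p ∷ pre) (w ∷ ws) (e ∷ es) = e ∷ pointwise-unifies⁺ σ pre ws es

    -- The run of a goal whose head is an instance of the head of a rule produced by T^β from
    -- the clause u ← ws ++ w ∷ zs: a first resolution step with the clause, then the facts
    -- solving ws, reaching the atom gℓ coming from w.
    module StepCase {N} (IH : LevelSound N) (u : Term) (ws : List Term) (w : Term) (zs : List Term)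
                    (u←vs∈P : P (u , ws ++ w ∷ zs)) (pre : List TermE) (preLen : length pre ≡ length ws)
                    (uℓ v : TermE)
                    (apart : Apart _∈vB_ (λ x → x ∈vR (u , ws ++ w ∷ zs))
                               (List.map (λ p → (p , nothing)) pre ++ [ (uℓ , v) ]) (level N ∪ IdB))
                    (θ : Subst) (mgu : IsMGU θ (zip pre (List.map just ws) ++ [ (uℓ , just w) ]))
                    (ρ : Subst) (R : IsRenaming ρ)
                    (g : Term) (ss : List Term) (K : ℕ) (g<K : VarsBelow K g) (ss<K : All (VarsBelow K) ss) (δ Θ : Subst)
                    (uθρΘ≡gδ : u ⟪ θ ⟫ ⟪ ρ ⟫ ⟪ Θ ⟫ ≡ g ⟪ δ ⟫) where

      vs : List Term
      vs = ws ++ w ∷ zs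

      Ω : Subst
      Ω = θ ∘ₛ (ρ ∘ₛ Θ)

      open FirstStep (resolve-first u vs u←vs∈P g ss K g<K ss<K δ Ω
                       (trans (sub-∘ u θ (ρ ∘ₛ Θ)) (trans (sub-∘ (u ⟪ θ ⟫) ρ Θ) uθρΘ≡gδ))) public

      pre-unified : Pointwise (λ p w′ → p ⟪ θ ⟫ₑ ≡ just (w′ ⟪ θ ⟫)) pre ws
      pre-unified = pointwise-unifies⁻ θ pre ws preLen (AllP.++⁻ˡ (zip pre (List.map just ws)) (proj₁ mgu))

      last-unified : uℓ ⟪ θ ⟫ₑ ≡ just (w ⟪ θ ⟫)
      last-unified = All.head (AllP.++⁻ʳ (zip pre (List.map just ws)) (proj₁ mgu))

      facts∈level : All (λ p → level N (p , nothing)) pre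
      facts∈level = All.map not-id (AllP.map⁻ (AllP.++⁻ˡ (List.map (λ p → (p , nothing)) pre) (proj₁ apart)))
        where
          not-id : ∀ {p} → (level N ∪ IdB) (p , nothing) → level N (p , nothing)
          not-id (inj₁ p∈) = p∈
          not-id (inj₂ (_ , _ , _ , ()))

      last∈level : (level N ∪ IdB) (uℓ , v)
      last∈level = All.head (AllP.++⁻ʳ (List.map (λ p → (p , nothing)) pre) (proj₁ apart))

      facts-apart : All (λ p → ∀ x → x ∈vB (p , nothing) → x ∈vR (u , vs) → ⊥) pre
      facts-apart = AllP.map⁻ (AllP.++⁻ˡ (List.map (λ p → (p , nothing)) pre) (proj₁ (proj₂ apart)))

      last-apart : ∀ x → x ∈vB (uℓ , v) → x ∈vR (u , vs) → ⊥
      last-apart = All.head (AllP.++⁻ʳ (List.map (λ p → (p , nothing)) pre) (proj₁ (proj₂ apart)))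

      ∈ws⇒∈clause : ∀ {x t} → t ∈ ws → x ∈v t → x ∈vR (u , vs)
      ∈ws⇒∈clause t∈ o = inj₂ (AnyP.++⁺ˡ (lose t∈ o))

      ∈w⇒∈clause : ∀ {x} → x ∈v w → x ∈vR (u , vs)
      ∈w⇒∈clause o = inj₂ (AnyP.++⁺ʳ ws (here o))

      Ω-on-clause : ∀ t → (∀ x → x ∈v t → x ∈vR (u , vs)) → t ⟪ Ω ⟫ ≡ t ⟪ π ⟫ ⟪ γ₀ ⟫ ⟪ λ₀ ⟫
      Ω-on-clause t t⊆ =
        trans (sub-local {Ω} {π ∘ₛ (γ₀ ∘ₛ λ₀)} t (λ x o → trans (Ω≈πγ₀λ₀ x (t⊆ x o)) (sym (sub-∘ (app π x) γ₀ λ₀))))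
              (trans (sub-∘ t π (γ₀ ∘ₛ λ₀)) (sub-∘ (t ⟪ π ⟫) γ₀ λ₀))

      as₀ R₀ : List Term
      as₀ = mapsub γ₀ (mapsub π ws)
      R₀ = mapsub γ₀ (mapsub π (w ∷ zs) ++ ss)

      after-first : mapsub γ₀ (mapsub π vs ++ ss) ≡ as₀ ++ R₀
      after-first = trans (cong (λ l → mapsub γ₀ (l ++ ss)) (map-++ (_⟪ π ⟫) ws (w ∷ zs)))
                     (trans (cong (mapsub γ₀) (++-assoc (mapsub π ws) (mapsub π (w ∷ zs)) ss))
                            (map-++ (_⟪ γ₀ ⟫) (mapsub π ws) (mapsub π (w ∷ zs) ++ ss)))

      facts-Ω : Pointwise (λ p a → p ⟪ Ω ⟫ₑ ≡ just (a ⟪ λ₀ ⟫)) pre as₀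
      facts-Ω = go ws (λ t∈ → t∈) pre-unified
        where
          go : ∀ {pre′} ws′ → (∀ {t} → t ∈ ws′ → t ∈ ws) → Pointwise (λ p w′ → p ⟪ θ ⟫ₑ ≡ just (w′ ⟪ θ ⟫)) pre′ ws′ →
               Pointwise (λ p a → p ⟪ Ω ⟫ₑ ≡ just (a ⟪ λ₀ ⟫)) pre′ (mapsub γ₀ (mapsub π ws′))
          go [] _ [] = []
          go {p ∷ _} (w′ ∷ ws′) ⊆ws (e ∷ es) =
            trans (sub-∘ₑ p θ (ρ ∘ₛ Θ)) (trans (cong (_⟪ ρ ∘ₛ Θ ⟫ₑ) e)
              (cong just (trans (sym (sub-∘ w′ θ (ρ ∘ₛ Θ))) (Ω-on-clause w′ (λ x o → ∈ws⇒∈clause (⊆ws (here refl)) o)))))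
            ∷ go ws′ (λ t∈ → ⊆ws (there t∈)) es

      after-first-below : All (VarsBelow K₁) (as₀ ++ R₀)
      after-first-below = subst (All (VarsBelow K₁)) after-first
        (VarsBelow-mapsub γ₀ (mapsub π vs ++ ss)
          (AllP.++⁺ (renamed-below vs (λ t∈ → t∈)) (All.map (λ {t} → VarsBelow-mono K≤K₁ t) ss<K)) γ₀-below)
        where
          renamed-below : ∀ l → (∀ {t} → t ∈ l → t ∈ vs) → All (VarsBelow K₁) (mapsub π l)
          renamed-below [] _ = []
          renamed-below (t ∷ l) ⊆vs = below ∷ renamed-below l (λ t∈ → ⊆vs (there t∈))
            where
              below : VarsBelow K₁ (t ⟪ π ⟫)
              below z o with ∈v-sub⁻ t π o
              ... | y , y∈t , z∈πy = π-below y (inj₂ (lose (⊆vs (here refl)) y∈t)) z z∈πy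

      open FactsRun (run-facts {N} IH Ω pre as₀ R₀ λ₀ K₁ facts∈level facts-Ω after-first-below) public
        renaming (ψ to ψf; λ′ to λf; K′ to Kf; run to run-facts′; λc≈ψλ′ to λ₀≈ψfλf; ψ-below to ψf-below; solved to facts-solved)

      gℓ : Term
      gℓ = w ⟪ π ⟫ ⟪ γ₀ ⟫ ⟪ ψf ⟫

      ssℓ : List Term
      ssℓ = mapsub ψf (mapsub γ₀ (mapsub π zs ++ ss))

      run-to-last : g ∷ ss ⇒⁺ gℓ ∷ ssℓ
      run-to-last = ⇒*-prepend step₁ (subst (_⇒* mapsub ψf R₀) (sym after-first) run-facts′)

      R₀-below : All (VarsBelow K₁) R₀
      R₀-below = proj₂ (AllP.++⁻ as₀ after-first-below)

      gℓ∷ssℓ-below : All (VarsBelow Kf) (gℓ ∷ ssℓ)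
      gℓ∷ssℓ-below = VarsBelow-mapsub ψf R₀ R₀-below ψf-below

      last-Ω : uℓ ⟪ Ω ⟫ₑ ≡ just (gℓ ⟪ λf ⟫)
      last-Ω = trans (sub-∘ₑ uℓ θ (ρ ∘ₛ Θ)) (trans (cong (_⟪ ρ ∘ₛ Θ ⟫ₑ) last-unified)
                 (cong just (trans (sym (sub-∘ w θ (ρ ∘ₛ Θ))) (trans (Ω-on-clause w (λ x o → ∈w⇒∈clause o))
                   (trans (sub-local {λ₀} {ψf ∘ₛ λf} (w ⟪ π ⟫ ⟪ γ₀ ⟫) (λ z o → λ₀≈ψfλf z (All.head R₀-below z o)))
                          (sub-∘ (w ⟪ π ⟫ ⟪ γ₀ ⟫) ψf λf))))))

      -- Given solutions Φ of the facts and ηℓ of the last rule, the unifier θ is more general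
      -- than the glued substitution, which yields the instance ηout of the derived rule.
      module Finish (Φ ηℓ : Subst) (uℓηℓ≡gℓΦ : uℓ ⟪ ηℓ ⟫ₑ ≡ just (gℓ ⟪ Φ ⟫)) where
        open Glue u vs π γ₀ ψf Φ ηℓ uℓ v facts-solved

        last-agrees : ∀ x → x ∈vB (uℓ , v) → app glued x ≡ app ηℓ x
        last-agrees x o = trans (glued-facts x (last-apart x o)) (factsPart-last facts-solved (proj₂ (proj₂ apart)) x o)

        pre-glued : Pointwise (λ p w′ → p ⟪ glued ⟫ₑ ≡ just (w′ ⟪ glued ⟫)) pre ws
        pre-glued = go ws (λ t∈ → t∈) facts-apart (factsPart-solves facts-solved (proj₂ (proj₂ apart)))
          where
            go : ∀ {pre′} ws′ → (∀ {t} → t ∈ ws′ → t ∈ ws) → All (λ p → ∀ x → x ∈vB (p , nothing) → x ∈vR (u , vs) → ⊥) pre′ →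
                 SolvesFacts facts-solved pre′ (mapsub γ₀ (mapsub π ws′)) →
                 Pointwise (λ p w′ → p ⟪ glued ⟫ₑ ≡ just (w′ ⟪ glued ⟫)) pre′ ws′
            go [] _ [] [] = []
            go (w′ ∷ ws′) ⊆ws (d ∷ ds) (k ∷ ks) =
              trans (k glued (λ x o → glued-facts x (d x (inj₁ o))))
                    (cong just (sym (glued-clause-term w′ (λ x o → ∈ws⇒∈clause (⊆ws (here refl)) o))))
              ∷ go ws′ (λ t∈ → ⊆ws (there t∈)) ds ks

        last-glued : uℓ ⟪ glued ⟫ₑ ≡ just (w ⟪ glued ⟫)
        last-glued = trans (sub-localₑ uℓ (λ x o → last-agrees x (inj₁ o)))
                       (trans uℓηℓ≡gℓΦ (cong just (sym (glued-clause-term w (λ x o → ∈w⇒∈clause o)))))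

        θ-factors-glued : Σ Subst λ γ → ∀ x → app glued x ≡ app θ x ⟪ γ ⟫
        θ-factors-glued = proj₂ mgu glued (AllP.++⁺ (pointwise-unifies⁺ glued pre ws pre-glued) (last-glued ∷ []))

        ηout : Subst
        ηout = renaming-inverse ρ R ∘ₛ proj₁ θ-factors-glued

        θρηout≡glued : ∀ t → t ⟪ θ ⟫ ⟪ ρ ⟫ ⟪ ηout ⟫ ≡ t ⟪ glued ⟫
        θρηout≡glued t = begin
          t ⟪ θ ⟫ ⟪ ρ ⟫ ⟪ ηout ⟫                                 ≡⟨ sub-∘ (t ⟪ θ ⟫ ⟪ ρ ⟫) (renaming-inverse ρ R) γ ⟩
          t ⟪ θ ⟫ ⟪ ρ ⟫ ⟪ renaming-inverse ρ R ⟫ ⟪ γ ⟫            ≡⟨ cong (_⟪ γ ⟫) (renaming-inverse-cancel ρ R (t ⟪ θ ⟫)) ⟩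
          t ⟪ θ ⟫ ⟪ γ ⟫                                          ≡⟨ sym (sub-∘ t θ γ) ⟩
          t ⟪ θ ∘ₛ γ ⟫                                           ≡⟨ sym (sub-cong (proj₂ θ-factors-glued) t) ⟩
          t ⟪ glued ⟫                                            ∎
          where
            open ≡-Reasoning
            γ = proj₁ θ-factors-glued

        head-instance : u ⟪ θ ⟫ ⟪ ρ ⟫ ⟪ ηout ⟫ ≡ g ⟪ γ₀ ⟫ ⟪ ψf ⟫ ⟪ Φ ⟫
        head-instance = trans (θρηout≡glued u)
                          (trans (glued-clause-term u (λ x o → inj₁ o)) (cong (λ s → s ⟪ ψf ⟫ ⟪ Φ ⟫) γ₀-unifies))

        body-instance : ∀ v₀ → v ≡ just v₀ → v₀ ⟪ θ ⟫ ⟪ ρ ⟫ ⟪ ηout ⟫ ≡ v₀ ⟪ ηℓ ⟫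
        body-instance v₀ refl = trans (θρηout≡glued v₀) (sub-local v₀ (λ x o → last-agrees x (inj₂ o)))

      finish-fact : zs ≡ [] → FactRun uℓ gℓ ssℓ Kf λf → FactRun (just (u ⟪ θ ⟫ ⟪ ρ ⟫)) g ss K δ
      finish-fact refl last = record
        { ψ = (γ₀ ∘ₛ ψf) ∘ₛ ψℓ ; λ′ = λℓ ; K′ = Kℓ
        ; δ≈ψλ′ = λ y y<K → factor-∘ δ (γ₀ ∘ₛ ψf) λf ψℓ λℓ y
                     (factor-∘ δ γ₀ λ₀ ψf λf y (δ≈γ₀λ₀ y y<K) (γ₀-below′ y y<K) λ₀≈ψfλf)
                     (VarsBelow-sub ψf (app γ₀ y) (γ₀-below′ y y<K) ψf-below) λf≈ψℓλℓ
        ; ψ-below = λ y y<K → VarsBelow-sub ψℓ (app (γ₀ ∘ₛ ψf) y)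
                                (VarsBelow-sub ψf (app γ₀ y) (γ₀-below′ y y<K) ψf-below) ψℓ-below
        ; η = ηout
        ; uη≡gψ = cong just (trans head-instance (sym (trans (sub-∘ g (γ₀ ∘ₛ ψf) ψℓ) (cong (_⟪ ψℓ ⟫) (sub-∘ g γ₀ ψf)))))
        ; run = run-to-last Plus.++ subst (gℓ ∷ ssℓ ⇒⁺_) (trans (cong (mapsub ψℓ) (mapsub-∘ γ₀ ψf ss))
                                                              (mapsub-∘ (γ₀ ∘ₛ ψf) ψℓ ss)) runℓ }
        where
          open FactRun last renaming (ψ to ψℓ; λ′ to λℓ; K′ to Kℓ; δ≈ψλ′ to λf≈ψℓλℓ; ψ-below to ψℓ-below;
                                      η to ηℓ; uη≡gψ to uℓηℓ≡gℓψℓ; run to runℓ)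
          open Finish ψℓ ηℓ uℓηℓ≡gℓψℓ
          γ₀-below′ : ∀ y → y < K → VarsBelow K₁ (app γ₀ y)
          γ₀-below′ y y<K = γ₀-below y (<-≤-trans y<K K≤K₁)

      finish-call : ∀ v₀ → v ≡ just v₀ → CallRun uℓ v₀ gℓ ssℓ → CallRun (just (u ⟪ θ ⟫ ⟪ ρ ⟫)) (v₀ ⟪ θ ⟫ ⟪ ρ ⟫) g ss
      finish-call v₀ v≡v₀ last = record
        { ψ = (γ₀ ∘ₛ ψf) ∘ₛ ψℓ ; τ = τℓ ; η = ηout
        ; uη≡gψτ = cong just (trans head-instance (trans (sub-∘ (g ⟪ γ₀ ⟫ ⟪ ψf ⟫) ψℓ τℓ)
                     (cong (_⟪ τℓ ⟫) (sym (trans (sub-∘ g (γ₀ ∘ₛ ψf) ψℓ) (cong (_⟪ ψℓ ⟫) (sub-∘ g γ₀ ψf)))))))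
        ; t = tℓ ; rest = restℓ
        ; run = run-to-last Plus.++ runℓ
        ; vη≡tτ = trans (body-instance v₀ v≡v₀) vℓηℓ≡tℓτℓ
        ; τ-trivial-or-flat = τℓ-trivial-or-flat }
        where
          open CallRun last renaming (ψ to ψℓ; τ to τℓ; η to ηℓ; uη≡gψτ to uℓηℓ≡gℓψℓτℓ; t to tℓ; rest to restℓ;
                                      run to runℓ; vη≡tτ to vℓηℓ≡tℓτℓ; τ-trivial-or-flat to τℓ-trivial-or-flat)
          open Finish (ψℓ ∘ₛ τℓ) ηℓ (trans uℓηℓ≡gℓψℓτℓ (cong just (sym (sub-∘ gℓ ψℓ τℓ))))

      -- The last rule is an identity rule f(xs) → f(xs): the call is gℓ itself.  If gℓ is a
      -- variable Y, the rule only predicts the instance f(xs) of it, so τ binds Y.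
      finish-identity : ∀ f xs → Distinct xs → uℓ ≡ just (idTerm f xs) → v ≡ just (idTerm f xs) →
                        CallRun (just (u ⟪ θ ⟫ ⟪ ρ ⟫)) (idTerm f xs ⟪ θ ⟫ ⟪ ρ ⟫) g ss
      finish-identity f xs d uℓ≡ v≡ = by-shape gℓ refl
        where
          call : ∀ τ → (∀ η → uℓ ⟪ η ⟫ₑ ≡ just (gℓ ⟪ τ ⟫) → idTerm f xs ⟪ η ⟫ ≡ gℓ ⟪ τ ⟫) →
                 (∀ y → app τ y ≡ var y) ⊎ Flat (gℓ ⟪ τ ⟫) → ∀ η → uℓ ⟪ η ⟫ₑ ≡ just (gℓ ⟪ τ ⟫) →
                 CallRun (just (u ⟪ θ ⟫ ⟪ ρ ⟫)) (idTerm f xs ⟪ θ ⟫ ⟪ ρ ⟫) g ss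
          call τ body trivial-or-flat η uℓη≡gℓτ = record
            { ψ = γ₀ ∘ₛ ψf ; τ = τ ; η = ηout
            ; uη≡gψτ = cong just (trans head-instance (cong (_⟪ τ ⟫) (sym (sub-∘ g γ₀ ψf))))
            ; t = gℓ ; rest = ssℓ ; run = run-to-last
            ; vη≡tτ = trans (body-instance (idTerm f xs) v≡) (body η uℓη≡gℓτ)
            ; τ-trivial-or-flat = trivial-or-flat }
            where open Finish τ η uℓη≡gℓτ

          id-body : ∀ τ η → uℓ ⟪ η ⟫ₑ ≡ just (gℓ ⟪ τ ⟫) → idTerm f xs ⟪ η ⟫ ≡ gℓ ⟪ τ ⟫
          id-body τ η e = just-injective (trans (cong (_⟪ η ⟫ₑ) (sym uℓ≡)) e)

          by-shape : ∀ t → t ≡ gℓ → CallRun (just (u ⟪ θ ⟫ ⟪ ρ ⟫)) (idTerm f xs ⟪ θ ⟫ ⟪ ρ ⟫) g ss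
          by-shape (var Y) t≡gℓ = call (Y ↦ idTerm f xs) (id-body (Y ↦ idTerm f xs)) (inj₂ (f , xs , gℓτ≡id)) idS
                                    (trans (sub-idₑ uℓ) (trans uℓ≡ (cong just (sym gℓτ≡id))))
            where
              gℓτ≡id : gℓ ⟪ Y ↦ idTerm f xs ⟫ ≡ idTerm f xs
              gℓτ≡id = trans (cong (_⟪ Y ↦ idTerm f xs ⟫) (sym t≡gℓ)) (↦-hit Y (idTerm f xs))
          by-shape (fn f′ ts) t≡gℓ = by-symbol f′ ts (fn-injectiveˡ (trans (just-injective (trans (sym (cong (_⟪ Ω ⟫ₑ) uℓ≡)) last-Ω))
                                                                       (cong (_⟪ λf ⟫) (sym t≡gℓ)))) t≡gℓ
            where
              by-symbol : ∀ f′ (ts : Vec Term (arity f′)) → f ≡ f′ → fn f′ ts ≡ gℓ →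
                          CallRun (just (u ⟪ θ ⟫ ⟪ ρ ⟫)) (idTerm f xs ⟪ θ ⟫ ⟪ ρ ⟫) g ss
              by-symbol .f ts refl fts≡gℓ =
                call idS (id-body idS) (inj₁ (λ y → refl)) (matcher xs ts)
                     (trans (cong (_⟪ matcher xs ts ⟫ₑ) uℓ≡)
                            (cong just (trans (cong (fn f) (matcher-matches xs ts d)) (trans fts≡gℓ (sym (sub-id gℓ))))))

    fact-last⇒no-rest : ∀ (zs : List Term) → (zs ≢ [] → nothing {A = Term} ≢ nothing) → zs ≡ []
    fact-last⇒no-rest [] _ = refl
    fact-last⇒no-rest (_ ∷ _) notE = ⊥-elim (notE (λ ()) refl)

    step-case′ : ∀ {N} → LevelSound N → ∀ u vs → P (u , vs) → ∀ ws w zs → vs ≡ ws ++ w ∷ zs →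
                 ∀ pre → length pre ≡ length ws → ∀ uℓ v →
                 Apart _∈vB_ (λ x → x ∈vR (u , vs)) (List.map (λ p → (p , nothing)) pre ++ [ (uℓ , v) ]) (level N ∪ IdB) →
                 (zs ≢ [] → v ≢ nothing) → ∀ θ → IsMGU θ (zip pre (List.map just ws) ++ [ (uℓ , just w) ]) →
                 ∀ ρ → IsRenaming ρ → ∀ g ss K → VarsBelow K g → All (VarsBelow K) ss → ∀ δ Θ →
                 just (u ⟪ θ ⟫ ⟪ ρ ⟫) ⟪ Θ ⟫ₑ ≡ just (g ⟪ δ ⟫) →
                 Run (just (u ⟪ θ ⟫ ⟪ ρ ⟫) , v ⟪ θ ⟫ₑ ⟪ ρ ⟫ₑ) g ss K δ
    step-case′ {N} IH u _ u←vs∈P ws w zs refl pre preLen uℓ nothing apart notE θ mgu ρ R g ss K g<K ss<K δ Θ e =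
      by-last last∈level
      where
        open StepCase {N} IH u ws w zs u←vs∈P pre preLen uℓ nothing apart θ mgu ρ R g ss K g<K ss<K δ Θ (just-injective e)
        by-last : (level N ∪ IdB) (uℓ , nothing) → FactRun (just (u ⟪ θ ⟫ ⟪ ρ ⟫)) g ss K δ
        by-last (inj₁ last∈) = finish-fact (fact-last⇒no-rest zs notE) (IH (uℓ , nothing) last∈ gℓ ssℓ Kf
                                 (All.head gℓ∷ssℓ-below) (All.tail gℓ∷ssℓ-below) λf Ω last-Ω)
        by-last (inj₂ (_ , _ , _ , ()))
    step-case′ {N} IH u _ u←vs∈P ws w zs refl pre preLen uℓ (just v₀) apart notE θ mgu ρ R g ss K g<K ss<K δ Θ e =
      by-last last∈level
      where
        open StepCase {N} IH u ws w zs u←vs∈P pre preLen uℓ (just v₀) apart θ mgu ρ R g ss K g<K ss<K δ Θ (just-injective e)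
        by-last : (level N ∪ IdB) (uℓ , just v₀) → CallRun (just (u ⟪ θ ⟫ ⟪ ρ ⟫)) (v₀ ⟪ θ ⟫ ⟪ ρ ⟫) g ss
        by-last (inj₁ last∈) = finish-call v₀ refl (IH (uℓ , just v₀) last∈ gℓ ssℓ Kf
                                 (All.head gℓ∷ssℓ-below) (All.tail gℓ∷ssℓ-below) λf Ω last-Ω)
        by-last (inj₂ (f , xs , d , refl)) = finish-identity f xs d refl refl

    step-case : ∀ {N} → LevelSound N → ∀ {b₀} → TβStep P (level N) b₀ → ∀ ρ → IsRenaming ρ →
                ∀ g ss K → VarsBelow K g → All (VarsBelow K) ss → ∀ δ Θ →
                proj₁ (renB ρ b₀) ⟪ Θ ⟫ₑ ≡ just (g ⟪ δ ⟫) → Run (renB ρ b₀) g ss K δ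
    step-case {N} IH st ρ R g ss K g<K ss<K δ Θ =
      subst (λ b → proj₁ (renB ρ b) ⟪ Θ ⟫ₑ ≡ just (g ⟪ δ ⟫) → Run (renB ρ b) g ss K δ) (sym result)
            (step-case′ {N} IH u vs inP ws w zs split pre preLen ui v apart notE θ mgu ρ R g ss K g<K ss<K δ Θ)
      where open TβStep st

    fact-case : ∀ u → P (u , []) → ∀ ρ → IsRenaming ρ → ∀ g ss K → VarsBelow K g → All (VarsBelow K) ss → ∀ δ Θ →
                just (u ⟪ ρ ⟫) ⟪ Θ ⟫ₑ ≡ just (g ⟪ δ ⟫) → FactRun (just (u ⟪ ρ ⟫)) g ss K δ
    fact-case u u←∈P ρ R g ss K g<K ss<K δ Θ e = record
      { ψ = γ₀ ; λ′ = λ₀ ; K′ = K₁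
      ; δ≈ψλ′ = δ≈γ₀λ₀
      ; ψ-below = λ y y<K → γ₀-below y (<-≤-trans y<K K≤K₁)
      ; η = renaming-inverse ρ R ∘ₛ (π ∘ₛ γ₀)
      ; uη≡gψ = cong just (trans (sub-∘ (u ⟪ ρ ⟫) (renaming-inverse ρ R) (π ∘ₛ γ₀))
                  (trans (cong (_⟪ π ∘ₛ γ₀ ⟫) (renaming-inverse-cancel ρ R u)) (trans (sub-∘ u π γ₀) γ₀-unifies)))
      ; run = Plus.[ step₁ ] }
      where open FirstStep (resolve-first u [] u←∈P g ss K g<K ss<K δ (ρ ∘ₛ Θ) (trans (sub-∘ u ρ Θ) (just-injective e)))

    level-sound : ∀ N → LevelSound N
    level-sound (suc N) .(renB ρ (just u , nothing)) (inj₁ (u , u←∈P , ρ , R , refl)) = fact-case u u←∈P ρ R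
    level-sound (suc N) .(renB ρ b₀) (inj₂ (b₀ , st , ρ , R , refl)) = step-case {N} (level-sound N) st ρ R

    -- The identity rules make binunf predict calls only up to instances: a flat instance of
    -- v is all that can be guaranteed in general.
    binunf-calls : ∀ {u v} → binunf P (u , just v) → (∀ η → ¬ Flat (v ⟪ η ⟫)) → ∀ Θ {g} → u ⟪ Θ ⟫ₑ ≡ just g →
                   Σ Subst λ η → Calls P g (just (v ⟪ η ⟫))
    binunf-calls {u} {v} (N , uv∈) never-flat Θ {g} uΘ≡g = η , rest , subst (λ s → [ g ] ⇒⁺ s ∷ rest) t≡vη run
      where
        open CallRun (level-sound N (u , just v) uv∈ g [] (varBound g) (varBound-correct g) [] idS Θ
                       (trans uΘ≡g (cong just (sym (sub-id g)))))
        t≡vη : t ≡ v ⟪ η ⟫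
        t≡vη with τ-trivial-or-flat
        ... | inj₁ τ-trivial = trans (sym (sub-fixed τ-trivial t)) (sym vη≡tτ)
        ... | inj₂ flat = ⊥-elim (never-flat η (subst Flat (sym vη≡tτ) flat))

  -- Soundness of patunf

  ≗ₛ-setoid : Setoid 0ℓ 0ℓ
  ≗ₛ-setoid = record
    { Carrier = Subst ; _≈_ = _≗ₛ_
    ; isEquivalence = record { refl = λ x → refl ; sym = λ h x → sym (h x) ; trans = λ h k x → trans (h x) (k x) } }

  module _ where
    open SetoidReasoning ≗ₛ-setoid

    pow-comm : ∀ σ τ → (σ ∘ₛ τ) ≗ₛ (τ ∘ₛ σ) → ∀ m → (pow σ m ∘ₛ τ) ≗ₛ (τ ∘ₛ pow σ m)
    pow-comm σ τ c zero x = sym (∘ₛ-identityʳ τ x)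
    pow-comm σ τ c (suc m) = begin
      (pow σ m ∘ₛ σ) ∘ₛ τ     ≈⟨ ∘ₛ-assoc (pow σ m) σ τ ⟩
      pow σ m ∘ₛ (σ ∘ₛ τ)     ≈⟨ ∘ₛ-congʳ (pow σ m) (σ ∘ₛ τ) (τ ∘ₛ σ) c ⟩
      pow σ m ∘ₛ (τ ∘ₛ σ)     ≈⟨ ∘ₛ-assoc (pow σ m) τ σ ⟨
      (pow σ m ∘ₛ τ) ∘ₛ σ     ≈⟨ ∘ₛ-congˡ (pow σ m ∘ₛ τ) (τ ∘ₛ pow σ m) σ (pow-comm σ τ c m) ⟩
      (τ ∘ₛ pow σ m) ∘ₛ σ     ≈⟨ ∘ₛ-assoc τ (pow σ m) σ ⟩
      τ ∘ₛ (pow σ m ∘ₛ σ)     ∎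

    pow-∘ : ∀ σ τ → (σ ∘ₛ τ) ≗ₛ (τ ∘ₛ σ) → ∀ m → pow (τ ∘ₛ σ) m ≗ₛ (pow τ m ∘ₛ pow σ m)
    pow-∘ σ τ c zero x = refl
    pow-∘ σ τ c (suc m) = begin
      pow (τ ∘ₛ σ) m ∘ₛ (τ ∘ₛ σ)                ≈⟨ ∘ₛ-congˡ (pow (τ ∘ₛ σ) m) (pow τ m ∘ₛ pow σ m) (τ ∘ₛ σ) (pow-∘ σ τ c m) ⟩
      (pow τ m ∘ₛ pow σ m) ∘ₛ (τ ∘ₛ σ)          ≈⟨ ∘ₛ-assoc (pow τ m) (pow σ m) (τ ∘ₛ σ) ⟩
      pow τ m ∘ₛ (pow σ m ∘ₛ (τ ∘ₛ σ))          ≈⟨ ∘ₛ-congʳ (pow τ m) _ _ (∘ₛ-assoc (pow σ m) τ σ) ⟨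
      pow τ m ∘ₛ ((pow σ m ∘ₛ τ) ∘ₛ σ)          ≈⟨ ∘ₛ-congʳ (pow τ m) _ _ (∘ₛ-congˡ (pow σ m ∘ₛ τ) (τ ∘ₛ pow σ m) σ (pow-comm σ τ c m)) ⟩
      pow τ m ∘ₛ ((τ ∘ₛ pow σ m) ∘ₛ σ)          ≈⟨ ∘ₛ-congʳ (pow τ m) _ _ (∘ₛ-assoc τ (pow σ m) σ) ⟩
      pow τ m ∘ₛ (τ ∘ₛ (pow σ m ∘ₛ σ))          ≈⟨ ∘ₛ-assoc (pow τ m) τ (pow σ m ∘ₛ σ) ⟨
      (pow τ m ∘ₛ τ) ∘ₛ (pow σ m ∘ₛ σ)          ∎

    -- This is why the n-th instance of a T^π step is a T^β step.
    pow-∘-instance : ∀ σ σᵢ μ μᵢ → Commutes σ σᵢ → Commutes σ μᵢ → ∀ m →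
                     (pow (σᵢ ∘ₛ σ) m ∘ₛ (μᵢ ∘ₛ μ)) ≗ₛ ((pow σᵢ m ∘ₛ μᵢ) ∘ₛ (pow σ m ∘ₛ μ))
    pow-∘-instance σ σᵢ μ μᵢ σσᵢ σμᵢ m = begin
      pow (σᵢ ∘ₛ σ) m ∘ₛ (μᵢ ∘ₛ μ)              ≈⟨ ∘ₛ-congˡ (pow (σᵢ ∘ₛ σ) m) (pow σᵢ m ∘ₛ pow σ m) (μᵢ ∘ₛ μ) (pow-∘ σ σᵢ σσᵢ m) ⟩
      (pow σᵢ m ∘ₛ pow σ m) ∘ₛ (μᵢ ∘ₛ μ)        ≈⟨ ∘ₛ-assoc (pow σᵢ m) (pow σ m) (μᵢ ∘ₛ μ) ⟩
      pow σᵢ m ∘ₛ (pow σ m ∘ₛ (μᵢ ∘ₛ μ))        ≈⟨ ∘ₛ-congʳ (pow σᵢ m) _ _ (∘ₛ-assoc (pow σ m) μᵢ μ) ⟨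
      pow σᵢ m ∘ₛ ((pow σ m ∘ₛ μᵢ) ∘ₛ μ)        ≈⟨ ∘ₛ-congʳ (pow σᵢ m) _ _ (∘ₛ-congˡ (pow σ m ∘ₛ μᵢ) (μᵢ ∘ₛ pow σ m) μ (pow-comm σ μᵢ σμᵢ m)) ⟩
      pow σᵢ m ∘ₛ ((μᵢ ∘ₛ pow σ m) ∘ₛ μ)        ≈⟨ ∘ₛ-congʳ (pow σᵢ m) _ _ (∘ₛ-assoc μᵢ (pow σ m) μ) ⟩
      pow σᵢ m ∘ₛ (μᵢ ∘ₛ (pow σ m ∘ₛ μ))        ≈⟨ ∘ₛ-assoc (pow σᵢ m) μᵢ (pow σ m ∘ₛ μ) ⟨
      (pow σᵢ m ∘ₛ μᵢ) ∘ₛ (pow σ m ∘ₛ μ)        ∎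

  pow-idS : ∀ m x → app (pow idS m) x ≡ var x
  pow-idS zero x = refl
  pow-idS (suc m) x = cong (_⟪ idS ⟫) (pow-idS m x)

  inst-hat : ∀ (t : TermE) m → inst (hat t) m ≡ t
  inst-hat t m = trans (sub-congₑ {pow idS m ∘ₛ idS} {idS} (λ x → cong (_⟪ idS ⟫) (pow-idS m x)) t) (sub-idₑ t)

  ∈v-sub⁻′ : ∀ {x} t τ → x ∈v (t ⟪ τ ⟫) → x ∈v t ⊎ x ∈vσ τ
  ∈v-sub⁻′ {x} t τ o with ∈v-sub⁻ t τ o
  ... | y , y∈t , x∈τy with app τ y ≟var y
  ...   | no τy≢y = inj₂ (inj₂ (y , τy≢y , x∈τy))
  ...   | yes τy≡y with subst (x ∈v_) τy≡y x∈τy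
  ...     | refl = inj₁ y∈t

  ∈vσ-∘⁻ : ∀ {x} α β → x ∈vσ (α ∘ₛ β) → x ∈vσ α ⊎ x ∈vσ β
  ∈vσ-∘⁻ {x} α β (inj₁ αβx≢x) with app α x ≟var x
  ... | yes αx≡x = inj₂ (inj₁ (λ e → αβx≢x (trans (cong (_⟪ β ⟫) αx≡x) e)))
  ... | no αx≢x = inj₁ (inj₁ αx≢x)
  ∈vσ-∘⁻ {x} α β (inj₂ (y , αβy≢y , o)) with ∈v-sub⁻′ (app α y) β o
  ... | inj₂ x∈β = inj₂ x∈β
  ... | inj₁ x∈αy with app α y ≟var y
  ...   | no αy≢y = inj₁ (inj₂ (y , αy≢y , x∈αy))
  ...   | yes αy≡y with subst (x ∈v_) αy≡y x∈αy
  ...     | refl = inj₂ (inj₁ (λ e → αβy≢y (trans (cong (_⟪ β ⟫) αy≡y) e)))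

  ∈vσ-pow⁻ : ∀ {x} σ m → x ∈vσ pow σ m → x ∈vσ σ
  ∈vσ-pow⁻ σ zero (inj₁ x≢x) = ⊥-elim (x≢x refl)
  ∈vσ-pow⁻ σ zero (inj₂ (_ , y≢y , _)) = ⊥-elim (y≢y refl)
  ∈vσ-pow⁻ σ (suc m) o with ∈vσ-∘⁻ (pow σ m) σ o
  ... | inj₁ x∈σᵐ = ∈vσ-pow⁻ σ m x∈σᵐ
  ... | inj₂ x∈σ = x∈σ

  ∈vE-inst⁻ : ∀ p m x → x ∈vE inst p m → x ∈vP p
  ∈vE-inst⁻ (pat (just s) σ μ) m x o with ∈v-sub⁻′ s (pow σ m ∘ₛ μ) o
  ... | inj₁ x∈s = inj₁ x∈s
  ... | inj₂ x∈σᵐμ with ∈vσ-∘⁻ (pow σ m) μ x∈σᵐμ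
  ...   | inj₁ x∈σᵐ = inj₂ (inj₁ (∈vσ-pow⁻ σ m x∈σᵐ))
  ...   | inj₂ x∈μ = inj₂ (inj₂ x∈μ)

  ∈vB-rulesAt⁻ : ∀ r m x → x ∈vB rulesAt r m → x ∈vPR r
  ∈vB-rulesAt⁻ (p , q) m x (inj₁ o) = inj₁ (∈vE-inst⁻ p m x o)
  ∈vB-rulesAt⁻ (p , q) m x (inj₂ o) = inj₂ (∈vE-inst⁻ q m x o)

  PatId⇒IdB : ∀ r m → PatId r → IdB (rulesAt r m)
  PatId⇒IdB .(hat (just (idTerm f xs)) , hat (just (idTerm f xs))) m (f , xs , d , refl) =
    f , xs , d , cong₂ _,_ (inst-hat (just (idTerm f xs)) m) (inst-hat (just (idTerm f xs)) m)

  sub-nothing⁻ : ∀ (t : TermE) τ → t ⟪ τ ⟫ₑ ≡ nothing → t ≡ nothing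
  sub-nothing⁻ nothing τ _ = refl

  renB-∘ : ∀ ρ ρ′ b → renB ρ′ (renB ρ b) ≡ renB (ρ ∘ₛ ρ′) b
  renB-∘ ρ ρ′ (u , v) = cong₂ _,_ (sym (sub-∘ₑ u ρ ρ′)) (sym (sub-∘ₑ v ρ ρ′))

  module _ (P : Program) where

    Tβ-mono : ∀ {U U′ : Pred BinRule 0ℓ} → (∀ {b} → U b → U′ b) → ∀ {b} → Tβ P U b → Tβ P U′ b
    Tβ-mono U⊆U′ (inj₁ fact) = inj₁ fact
    Tβ-mono {U} {U′} U⊆U′ (inj₂ (b₀ , st , variant)) = inj₂ (b₀ , st′ , variant)
      where
        open TβStep st
        widen : ∀ {b} → (U ∪ IdB) b → (U′ ∪ IdB) b
        widen (inj₁ b∈U) = inj₁ (U⊆U′ b∈U)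
        widen (inj₂ b∈id) = inj₂ b∈id
        st′ : TβStep P U′ b₀
        st′ = record { u = u ; vs = vs ; inP = inP ; ws = ws ; w = w ; zs = zs ; split = split ; pre = pre
                     ; preLen = preLen ; ui = ui ; v = v ; apart = All.map widen (proj₁ apart) , proj₂ apart
                     ; notE = notE ; θ = θ ; mgu = mgu ; result = result }

    level-mono : ∀ {m n} → m ≤ n → ∀ {b} → level P m b → level P n b
    level-mono {suc m} (s≤s m≤n) b∈ = Tβ-mono (level-mono m≤n) b∈

    binunf-variant-closed : ∀ {b b′} → binunf P b → VariantB b b′ → binunf P b′
    binunf-variant-closed (suc N , inj₁ (u , u←∈P , ρ , R , refl)) (ρ′ , R′ , refl) =
      suc N , inj₁ (u , u←∈P , ρ ∘ₛ ρ′ , ∘ₛ-renaming {ρ} {ρ′} R R′ , renB-∘ ρ ρ′ (just u , nothing))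
    binunf-variant-closed (suc N , inj₂ (b₀ , st , ρ , R , refl)) (ρ′ , R′ , refl) =
      suc N , inj₂ (b₀ , st , ρ ∘ₛ ρ′ , ∘ₛ-renaming {ρ} {ρ′} R R′ , renB-∘ ρ ρ′ b₀)

    common-level : ∀ {U} → Correct P U → ∀ m (rs : List PatRule) → All (U ∪ PatId) rs →
                   Σ ℕ λ M → All (λ r → (level P M ∪ IdB) (rulesAt r m)) rs
    common-level U-correct m [] [] = 0 , []
    common-level U-correct m (r ∷ rs) (inj₂ r∈id ∷ rs∈) with common-level U-correct m rs rs∈
    ... | M , rs∈M = M , inj₂ (PatId⇒IdB r m r∈id) ∷ rs∈M
    common-level U-correct m (r ∷ rs) (inj₁ r∈U ∷ rs∈) with common-level U-correct m rs rs∈ | U-correct r r∈U m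
    ... | M , rs∈M | N , r∈N = M ⊔ N , inj₁ (level-mono (m≤n⊔m M N) r∈N) ∷ All.map raise rs∈M
      where
        raise : ∀ {b} → (level P M ∪ IdB) b → (level P (M ⊔ N) ∪ IdB) b
        raise (inj₁ b∈M) = inj₁ (level-mono (m≤m⊔n M N) b∈M)
        raise (inj₂ b∈id) = inj₂ b∈id

    Tπ-step-correct : ∀ {U} → Correct P U → ∀ {r₀} → TπStep P U r₀ → ∀ m → binunf P (rulesAt r₀ m)
    Tπ-step-correct U-correct st m =
      subst (λ r → binunf P (rulesAt r m)) (sym result) (suc M , inj₂ (b₀ , stβ , idS , idS-renaming , b₀-instance))
      where
        open TπStep st
        premises : List PatRule
        premises = List.map (λ p → (p , hat nothing)) pre ++ [ (pᵢ , pat v σᵢ μᵢ) ]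
        M = proj₁ (common-level U-correct m premises (proj₁ apart))
        premises-at-m : List.map (λ p → (p , nothing)) (List.map (λ p → inst p m) pre) ++ [ (inst pᵢ m , inst (pat v σᵢ μᵢ) m) ]
                        ≡ List.map (λ r → rulesAt r m) premises
        premises-at-m = trans (cong (_++ [ (inst pᵢ m , inst (pat v σᵢ μᵢ) m) ]) (trans (sym (map-∘ pre)) (map-∘ pre)))
                              (sym (map-++ (λ r → rulesAt r m) (List.map (λ p → (p , hat nothing)) pre) [ (pᵢ , pat v σᵢ μᵢ) ]))
        premises-apart : Apart _∈vB_ (λ x → x ∈vR (u , vs)) (List.map (λ r → rulesAt r m) premises) (level P M ∪ IdB)
        premises-apart =
          AllP.map⁺ (proj₂ (common-level U-correct m premises (proj₁ apart))) ,
          AllP.map⁺ (All.map (λ {r} h x o → h x (∈vB-rulesAt⁻ r m x o)) (proj₁ (proj₂ apart))) ,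
          AllPairsP.map⁺ (AllPairs.map (λ {r} {r′} h x o o′ → h x (∈vB-rulesAt⁻ r m x o) (∈vB-rulesAt⁻ r′ m x o′))
                                       (proj₂ (proj₂ apart)))
        θ : Subst
        θ = pow σ m ∘ₛ μ
        eqns-at-m : zip (List.map (λ p → inst p m) pre) (List.map (λ t → inst (hat (just t)) m) ws) ++ [ (inst pᵢ m , inst (hat (just w)) m) ]
                    ≡ zip (List.map (λ p → inst p m) pre) (List.map just ws) ++ [ (inst pᵢ m , just w) ]
        eqns-at-m = cong₂ (λ a b → zip (List.map (λ p → inst p m) pre) a ++ [ (inst pᵢ m , b) ])
                          (map-cong (λ t → inst-hat (just t) m) ws) (inst-hat (just w) m)
        b₀ : BinRule
        b₀ = (just (u ⟪ θ ⟫) , inst (pat v σᵢ μᵢ) m ⟪ θ ⟫ₑ)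
        stβ : TβStep P (level P M) b₀
        stβ = record { u = u ; vs = vs ; inP = inP ; ws = ws ; w = w ; zs = zs ; split = split
                     ; pre = List.map (λ p → inst p m) pre ; preLen = trans (length-map _ pre) preLen
                     ; ui = inst pᵢ m ; v = inst (pat v σᵢ μᵢ) m
                     ; apart = subst (λ l → Apart _∈vB_ (λ x → x ∈vR (u , vs)) l (level P M ∪ IdB))
                                     (sym premises-at-m) premises-apart
                     ; notE = λ zs≢[] ≡e → notE zs≢[] (sub-nothing⁻ v (pow σᵢ m ∘ₛ μᵢ) ≡e)
                     ; θ = θ ; mgu = subst (IsMGU θ) eqns-at-m (mgu m) ; result = refl }
        b₀-instance : rulesAt (pat (just u) σ μ , pat v (σᵢ ∘ₛ σ) (μᵢ ∘ₛ μ)) m ≡ renB idS b₀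
        b₀-instance = cong₂ _,_ (sym (cong just (sub-id (u ⟪ θ ⟫))))
          (sym (trans (sub-idₑ _) (trans (sym (sub-∘ₑ v (pow σᵢ m ∘ₛ μᵢ) θ))
                 (sub-congₑ (λ x → sym (pow-∘-instance σ σᵢ μ μᵢ commσ commμ m x)) v))))

    patunf-correct-at : ∀ B → Correct P B → ∀ k → Correct P (iter (Tπ P B) k)
    patunf-correct-at B B-correct (suc k) r (inj₁ (b , b∈B , variant)) n with variant n
    ... | m , vb = binunf-variant-closed (B-correct b b∈B m) vb
    patunf-correct-at B B-correct (suc k) r (inj₂ (r₀ , st , variant)) n with variant n
    ... | m , vb = binunf-variant-closed (Tπ-step-correct (patunf-correct-at B B-correct k) st m) vb

    patunf-correct : ∀ B → Correct P B → Correct P (patunf P B)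
    patunf-correct B B-correct r (k , r∈) = patunf-correct-at B B-correct k r r∈

  VarFree : ∀ {m} → Tm m → Set
  VarFree c = ∀ x → ¬ (x ∈v c)

  mutual
    plug-sub : ∀ {m} (c : Tm m) (ss : Vec Term m) θ → VarFree c → plug c ss ⟪ θ ⟫ ≡ plug c (Vec.map (_⟪ θ ⟫) ss)
    plug-sub (var x) ss θ c-free = ⊥-elim (c-free x refl)
    plug-sub (fn f cs) ss θ c-free = cong (fn f) (plugs-sub cs ss θ c-free)
    plug-sub (hole i) ss θ c-free = sym (VecP.lookup-map i (_⟪ θ ⟫) ss)

    plugs-sub : ∀ {m n} (cs : Vec (Tm m) n) (ss : Vec Term m) θ → (∀ x → ¬ (x ∈vs cs)) →
                plugs cs ss ⟪ θ ⟫s ≡ plugs cs (Vec.map (_⟪ θ ⟫) ss)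
    plugs-sub [] ss θ cs-free = refl
    plugs-sub (c ∷ cs) ss θ cs-free =
      cong₂ _∷_ (plug-sub c ss θ (λ x o → cs-free x (inj₁ o))) (plugs-sub cs ss θ (λ x o → cs-free x (inj₂ o)))

  mutual
    ∈v-plug⁻ : ∀ {k x} (C : Tm 1) (D : Tm k) → x ∈v plug C (D ∷ []) → x ∈v C ⊎ x ∈v D
    ∈v-plug⁻ (var y) D o = inj₁ o
    ∈v-plug⁻ (fn f cs) D o = ∈vs-plugs⁻ cs D o
    ∈v-plug⁻ (hole zero) D o = inj₂ o

    ∈vs-plugs⁻ : ∀ {k n x} (cs : Vec (Tm 1) n) (D : Tm k) → x ∈vs plugs cs (D ∷ []) → x ∈vs cs ⊎ x ∈v D
    ∈vs-plugs⁻ (c ∷ cs) D (inj₁ o) with ∈v-plug⁻ c D o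
    ... | inj₁ x∈c = inj₁ (inj₁ x∈c)
    ... | inj₂ x∈D = inj₂ x∈D
    ∈vs-plugs⁻ (c ∷ cs) D (inj₂ o) with ∈vs-plugs⁻ cs D o
    ... | inj₁ x∈cs = inj₁ (inj₂ x∈cs)
    ... | inj₂ x∈D = inj₂ x∈D

  mutual
    plug-assoc : ∀ {k} (C D : Tm 1) (t : Tm k) → plug (plug C (D ∷ [])) (t ∷ []) ≡ plug C (plug D (t ∷ []) ∷ [])
    plug-assoc (var x) D t = refl
    plug-assoc (fn f cs) D t = cong (fn f) (plugs-assoc cs D t)
    plug-assoc (hole zero) D t = refl

    plugs-assoc : ∀ {k n} (cs : Vec (Tm 1) n) (D : Tm 1) (t : Tm k) →
                  plugs (plugs cs (D ∷ [])) (t ∷ []) ≡ plugs cs (plug D (t ∷ []) ∷ [])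
    plugs-assoc [] D t = refl
    plugs-assoc (c ∷ cs) D t = cong₂ _∷_ (plug-assoc c D t) (plugs-assoc cs D t)

  cpow-varFree : ∀ (C : Tm 1) → VarFree C → ∀ n → VarFree (cpow C n)
  cpow-varFree C C-free zero x ()
  cpow-varFree C C-free (suc n) x o with ∈v-plug⁻ C (cpow C n) o
  ... | inj₁ x∈C = C-free x x∈C
  ... | inj₂ x∈Cⁿ = cpow-varFree C C-free n x x∈Cⁿ

  cpowApp-+ : ∀ (C : Tm 1) a b t → cpowApp C a (cpowApp C b t) ≡ cpowApp C (a + b) t
  cpowApp-+ C zero b t = refl
  cpowApp-+ C (suc a) b t =
    trans (plug-assoc C (cpow C a) (cpowApp C b t))
      (trans (cong (λ s → plug C (s ∷ [])) (cpowApp-+ C a b t)) (sym (plug-assoc C (cpow C (a + b)) t)))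

  cpowApp-sub : ∀ (C : Tm 1) → VarFree C → ∀ a t θ → cpowApp C a t ⟪ θ ⟫ ≡ cpowApp C a (t ⟪ θ ⟫)
  cpowApp-sub C C-free a t θ = plug-sub (cpow C a) (t ∷ []) θ (cpow-varFree C C-free a)

  ∈v-cpowApp⁻ : ∀ (C : Tm 1) → VarFree C → ∀ a t x → x ∈v cpowApp C a t → x ∈v t
  ∈v-cpowApp⁻ C C-free a t x o with ∈v-plug⁻ (cpow C a) t o
  ... | inj₁ x∈Cᵃ = ⊥-elim (cpow-varFree C C-free a x x∈Cᵃ)
  ... | inj₂ x∈t = x∈t

  mutual
    eval-embedU : ∀ (t : Term) n → eval (embedU t) n ≡ t
    eval-embedU (var x) n = refl
    eval-embedU (fn f ts) n = cong (fn f) (evals-embedUs ts n)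

    evals-embedUs : ∀ {k} (ts : Vec Term k) n → evals (embedUs ts) n ≡ ts
    evals-embedUs [] n = refl
    evals-embedUs (t ∷ ts) n = cong₂ _∷_ (eval-embedU t n) (evals-embedUs ts n)

  mutual
    eval-plugU : ∀ {m} (c : Tm m) (us : Vec UTm m) n → eval (plugU c us) n ≡ plug c (Vec.map (λ u → eval u n) us)
    eval-plugU (var x) us n = refl
    eval-plugU (fn f cs) us n = cong (fn f) (evals-plugUs cs us n)
    eval-plugU (hole i) us n = sym (VecP.lookup-map i (λ u → eval u n) us)

    evals-plugUs : ∀ {m k} (cs : Vec (Tm m) k) (us : Vec UTm m) n →
                   evals (plugUs cs us) n ≡ plugs cs (Vec.map (λ u → eval u n) us)
    evals-plugUs [] us n = refl
    evals-plugUs (c ∷ cs) us n = cong₂ _∷_ (eval-plugU c us n) (evals-plugUs cs us n)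

  mutual
    eval-subOcc : ∀ (s : Term) (f : ∀ x → x ∈v s → UTm) τ n → (∀ x o → eval (f x o) n ≡ app τ x) →
                  eval (subOcc s f) n ≡ s ⟪ τ ⟫
    eval-subOcc (var y) f τ n h = h y refl
    eval-subOcc (fn g ts) f τ n h = cong (fn g) (evals-subOccs ts f τ n h)

    evals-subOccs : ∀ {k} (ts : Vec Term k) (f : ∀ x → x ∈vs ts → UTm) τ n → (∀ x o → eval (f x o) n ≡ app τ x) →
                    evals (subOccs ts f) n ≡ ts ⟪ τ ⟫s
    evals-subOccs [] f τ n h = refl
    evals-subOccs (t ∷ ts) f τ n h =
      cong₂ _∷_ (eval-subOcc t (λ x o → f x (inj₁ o)) τ n (λ x o → h x (inj₁ o)))
                (evals-subOccs ts (λ x o → f x (inj₂ o)) τ n (λ x o → h x (inj₂ o)))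

  pow-fixed : ∀ σ x → app σ x ≡ var x → ∀ n → app (pow σ n) x ≡ var x
  pow-fixed σ x σx≡x zero = refl
  pow-fixed σ x σx≡x (suc n) = trans (cong (_⟪ σ ⟫) (pow-fixed σ x σx≡x n)) σx≡x

  pow-cpowApp : ∀ σ x (C : Tm 1) → VarFree C → ∀ a → app σ x ≡ cpowApp C a (var x) →
                ∀ n → app (pow σ n) x ≡ cpowApp C (a * n) (var x)
  pow-cpowApp σ x C C-free a σx≡ zero = cong (λ e → cpowApp C e (var x)) (sym (*-zeroʳ a))
  pow-cpowApp σ x C C-free a σx≡ (suc n) = begin
    app (pow σ n) x ⟪ σ ⟫                      ≡⟨ cong (_⟪ σ ⟫) (pow-cpowApp σ x C C-free a σx≡ n) ⟩
    cpowApp C (a * n) (var x) ⟪ σ ⟫            ≡⟨ cpowApp-sub C C-free (a * n) (var x) σ ⟩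
    cpowApp C (a * n) (app σ x)                ≡⟨ cong (cpowApp C (a * n)) σx≡ ⟩
    cpowApp C (a * n) (cpowApp C a (var x))    ≡⟨ cpowApp-+ C (a * n) a (var x) ⟩
    cpowApp C (a * n + a) (var x)              ≡⟨ cong (λ e → cpowApp C e (var x)) (trans (+-comm (a * n) a) (sym (*-suc a n))) ⟩
    cpowApp C (a * suc n) (var x)              ∎
    where open ≡-Reasoning

  eval-thetaAt : ∀ {σ μ x} (w : SimpleAt σ μ x) n → eval (thetaAt w) n ≡ app (pow σ n ∘ₛ μ) x
  eval-thetaAt {σ} {μ} {x} w n with SimpleAt.dec w
  ... | yes σx≡x = trans (eval-embedU (app μ x) n) (sym (cong (_⟪ μ ⟫) (pow-fixed σ x σx≡x n)))
  ... | no _ = begin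
    cpowApp C (a * n + b) (eval (embedU t) n)   ≡⟨ cong (cpowApp C (a * n + b)) (eval-embedU t n) ⟩
    cpowApp C (a * n + b) t                     ≡⟨ cpowApp-+ C (a * n) b t ⟨
    cpowApp C (a * n) (cpowApp C b t)           ≡⟨ cong (cpowApp C (a * n)) eqμ ⟨
    cpowApp C (a * n) (app μ x)                 ≡⟨ cpowApp-sub C (noVar c) (a * n) (var x) μ ⟨
    cpowApp C (a * n) (var x) ⟪ μ ⟫             ≡⟨ cong (_⟪ μ ⟫) (pow-cpowApp σ x C (noVar c) a eqσ n) ⟨
    app (pow σ n) x ⟪ μ ⟫                       ∎
    where
      open ≡-Reasoning
      open SimpleAt w
      C = ctx c

  inst-upsRep : ∀ p (W : Simple p) u′ → upsRep p W ≡ just u′ → ∀ n → inst p n ≡ just (eval u′ n)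
  inst-upsRep (pat (just s) σ μ) W .(subOcc s (λ x o → thetaAt (W x o))) refl n =
    cong just (sym (eval-subOcc s (λ x o → thetaAt (W x o)) (pow σ n ∘ₛ μ) n (λ x o → eval-thetaAt (W x o) n)))

  -- Special pattern rules

  alphaQ≤n⇒cleared : ∀ a a′ X n → alphaQ a a′ X ℚ.≤ ℕtoℚ n → ∀ j → a′ ∸ a ≡ suc j → X ℤ.≤ + (n * suc j)
  alphaQ≤n⇒cleared a a′ X n α≤n j a′∸a≡ with a′ ∸ a
  alphaQ≤n⇒cleared a a′ X n α≤n j refl | .(suc j) = X/[1+j]≤n⇒X≤n*[1+j] X j n α≤n

  mutual
    plug-flat⇒var-at-hole : ∀ {m} (c : Tm m) (us : Vec Term m) i → HoleOcc i c → (∀ j → c ≢ hole j) →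
                            Flat (plug c us) → Σ ℕ λ y → lookup us i ≡ var y
    plug-flat⇒var-at-hole (hole j) us i o not-hole flat = ⊥-elim (not-hole j refl)
    plug-flat⇒var-at-hole (fn g cs) us i o not-hole (f , xs , e) with fn-injectiveˡ e
    ... | refl = plugs-flat⇒var-at-hole cs us i o xs (fn-injectiveʳ e)

    plugs-flat⇒var-at-hole : ∀ {m k} (cs : Vec (Tm m) k) (us : Vec Term m) i → HoleOccs i cs → (xs : Vec ℕ k) →
                             plugs cs us ≡ Vec.map var xs → Σ ℕ λ y → lookup us i ≡ var y
    plugs-flat⇒var-at-hole (fn g ds ∷ cs) us i (inj₁ o) (x ∷ xs) e with cong Vec.head e
    ... | ()
    plugs-flat⇒var-at-hole (hole j ∷ cs) us .j (inj₁ refl) (x ∷ xs) e = x , cong Vec.head e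
    plugs-flat⇒var-at-hole (c ∷ cs) us i (inj₂ o) (x ∷ xs) e = plugs-flat⇒var-at-hole cs us i o xs (cong Vec.tail e)

  plug-tabulate-sub : ∀ {m} (c : Tm m) → VarFree c → (f : Fin m → Term) → ∀ θ →
                      plug c (tabulate f) ⟪ θ ⟫ ≡ plug c (tabulate (λ i → f i ⟪ θ ⟫))
  plug-tabulate-sub c c-free f θ = trans (plug-sub c (tabulate f) θ c-free) (cong (plug c) (sym (VecP.tabulate-∘ (_⟪ θ ⟫) f)))

  varName : Term → ℕ
  varName (var y) = y
  varName (fn _ _) = 0

  varsAmong : ∀ {l} → (Fin l → Term) → List ℕ
  varsAmong {zero} f = []
  varsAmong {suc l} f = varName (f zero) ∷ varsAmong (λ i → f (suc i))

  varsAmong-complete : ∀ {l} (f : Fin l → Term) i x → f i ≡ var x → x ∈ varsAmong f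
  varsAmong-complete f zero x f0≡x = here (cong varName (sym f0≡x))
  varsAmong-complete f (suc i) x fi≡x = there (varsAmong-complete (λ i → f (suc i)) i x fi≡x)

  module SpecialRule {r : PatRule} (W : Special r) where
    open Special W

    lhsArg rhsArg : ℕ → Fin m → Term
    lhsArg j i = cpowApp (ctx (cs i)) (as i * j + bs i) (ts i)
    rhsArg j i = cpowApp (ctx (cs i)) (as' i * j + bs' i) (ts i ⟪ ρ ⟫)

    lhsAt rhsAt : ℕ → Term
    lhsAt j = plug c (tabulate (lhsArg j))
    rhsAt j = plug c (tabulate (rhsArg j))

    eval-tabulate-up : ∀ j (cs′ : Fin m → Chi1) (as′ bs′ : Fin m → ℕ) (ts′ : Fin m → Term) →
                       Vec.map (λ u → eval u j) (tabulate (λ i → up (cs′ i) (as′ i) (bs′ i) (embedU (ts′ i))))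
                       ≡ tabulate (λ i → cpowApp (ctx (cs′ i)) (as′ i * j + bs′ i) (ts′ i))
    eval-tabulate-up j cs′ as′ bs′ ts′ =
      trans (sym (VecP.tabulate-∘ (λ u → eval u j) (λ i → up (cs′ i) (as′ i) (bs′ i) (embedU (ts′ i)))))
            (VecP.tabulate-cong (λ i → cong (cpowApp (ctx (cs′ i)) (as′ i * j + bs′ i)) (eval-embedU (ts′ i) j)))

    lhs-inst : ∀ j → inst (proj₁ r) j ≡ just (lhsAt j)
    lhs-inst j with inP
    ... | u′ , rep , ∼u′ = trans (inst-upsRep (proj₁ r) simpP u′ rep j)
      (cong just (trans (sym (∼u′ j)) (trans (eval-plugU c _ j) (cong (plug c) (eval-tabulate-up j cs as bs ts)))))

    rhs-inst : ∀ j → inst (proj₂ r) j ≡ just (rhsAt j)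
    rhs-inst j with inQ
    ... | u′ , rep , ∼u′ = trans (inst-upsRep (proj₂ r) simpQ u′ rep j)
      (cong just (trans (sym (∼u′ j)) (trans (eval-plugU c _ j) (cong (plug c) (eval-tabulate-up j cs as' bs' (λ i → ts i ⟪ ρ ⟫))))))

    -- Some tᵢ is ground and some tⱼ is a variable, so c is not a bare hole and has a ground
    -- argument, which no instance can turn into a variable.
    c-not-hole : ∀ i → c ≢ hole i
    c-not-hole i refl with cCtx (proj₁ gEx) | cCtx (proj₁ vEx) | proj₂ vEx
    ... | refl | refl | (x , tᵢ≡x) = proj₂ gEx x (subst (x ∈v_) (sym tᵢ≡x) refl)

    rhs-not-flat : ∀ j η → ¬ Flat (rhsAt j ⟪ η ⟫)
    rhs-not-flat j η flat with plug-flat⇒var-at-hole c (Vec.map (_⟪ η ⟫) (tabulate (rhsArg j))) (proj₁ gEx)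
                                 (cCtx (proj₁ gEx)) c-not-hole (subst Flat (plug-sub c (tabulate (rhsArg j)) η cNoVar) flat)
    ... | y , at-i₀ = ground (proj₁ z) (proj₁ (proj₂ z))
      where
        i₀ = proj₁ gEx
        ground = proj₂ gEx
        Cᵢ = ctx (cs i₀)
        e = as' i₀ * j + bs' i₀
        rhsArgη≡y : rhsArg j i₀ ⟪ η ⟫ ≡ var y
        rhsArgη≡y = trans (sym (trans (VecP.lookup-map i₀ (_⟪ η ⟫) (tabulate (rhsArg j)))
                                      (cong (_⟪ η ⟫) (VecP.lookup∘tabulate (rhsArg j) i₀)))) at-i₀
        y∈tρη : y ∈v (ts i₀ ⟪ ρ ⟫ ⟪ η ⟫)
        y∈tρη = ∈v-cpowApp⁻ Cᵢ (noVar (cs i₀)) e (ts i₀ ⟪ ρ ⟫ ⟪ η ⟫) y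
                  (subst (y ∈v_) (trans (sym rhsArgη≡y) (cpowApp-sub Cᵢ (noVar (cs i₀)) e (ts i₀ ⟪ ρ ⟫) η)) refl)
        z = ∈v-sub⁻ (ts i₀) ρ (proj₁ (proj₂ (∈v-sub⁻ (ts i₀ ⟪ ρ ⟫) η y∈tρη)))

    varIndex? : ∀ x → Dec (Σ (Fin m) λ i → ts i ≡ var x)
    varIndex? x = FinP.any? (λ i → ts i ≟var x)

    module Shift (n : ℕ) (η : Subst) where
      gap : ℕ
      gap = (a' * n + d') ∸ (a * (n + k) + d)

      -- Deepen every variable argument tᵢ by the gap between the exponents; condition (2)
      -- makes the context cᵢ depend on the variable only.
      η′ : Subst
      η′ = mkSubst deepen (varsAmong ts , fixed)
        where
          deepen : ℕ → Term
          deepen x with varIndex? x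
          ... | yes (i , _) = cpowApp (ctx (cs i)) gap (app ρ x ⟪ η ⟫)
          ... | no _ = var x
          fixed : ∀ x → x ∉ varsAmong ts → deepen x ≡ var x
          fixed x x∉ with varIndex? x
          ... | yes (i , tᵢ≡x) = ⊥-elim (x∉ (varsAmong-complete ts i x tᵢ≡x))
          ... | no _ = refl

      η′-at : ∀ i x → ts i ≡ var x → app η′ x ≡ cpowApp (ctx (cs i)) gap (app ρ x ⟪ η ⟫)
      η′-at i x tᵢ≡x with varIndex? x
      ... | yes (i′ , tᵢ′≡x) = cong (λ C → cpowApp C gap (app ρ x ⟪ η ⟫)) (sym (cond2 i i′ (x , tᵢ≡x) (trans tᵢ≡x (sym tᵢ′≡x))))
      ... | no none = ⊥-elim (none (i , tᵢ≡x))

      ground-exponents : ∀ i → Ground (ts i) → as i * (n + k) + bs i ≡ as' i * n + bs' i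
      ground-exponents i g rewrite proj₁ (gA i g) | proj₂ (gA i g) | proj₁ (gB i g) | proj₂ (gB i g) = begin
        h * (n + k) + b      ≡⟨ trans (cong (_+ b) (*-distribˡ-+ h n k)) (+-assoc (h * n) (h * k) b) ⟩
        h * n + (h * k + b)  ≡⟨ cong (λ e → h * n + (e + b)) (trans (*-comm h k) kEq) ⟩
        h * n + (b' ∸ b + b) ≡⟨ cong (_+_ (h * n)) (m∸n+n≡m b≤b') ⟩
        h * n + b'           ∎
        where open ≡-Reasoning

      arg-shift : a * (n + k) + d ≤ a' * n + d' → ∀ i → lhsArg (n + k) i ⟪ η′ ⟫ ≡ rhsArg n i ⟪ η ⟫
      arg-shift fits i with cond1 i
      ... | inj₂ g = begin
        lhsArg (n + k) i ⟪ η′ ⟫                                 ≡⟨ sub-ground (λ x o → g x (∈v-cpowApp⁻ Cᵢ Cᵢ-free (as i * (n + k) + bs i) (ts i) x o)) η′ ⟩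
        cpowApp Cᵢ (as i * (n + k) + bs i) (ts i)               ≡⟨ cong₂ (cpowApp Cᵢ) (ground-exponents i g) (sym (sub-ground g ρ)) ⟩
        cpowApp Cᵢ (as' i * n + bs' i) (ts i ⟪ ρ ⟫)             ≡⟨ sub-ground (λ x o → g x (ground-∈ x o)) η ⟨
        rhsArg n i ⟪ η ⟫                                        ∎
        where
          open ≡-Reasoning
          Cᵢ = ctx (cs i)
          Cᵢ-free = noVar (cs i)
          ground-∈ : ∀ x → x ∈v rhsArg n i → x ∈v ts i
          ground-∈ x o = ∈v-cpowApp⁻ Cᵢ Cᵢ-free (as' i * n + bs' i) (ts i) x
                           (subst (λ t → x ∈v cpowApp Cᵢ (as' i * n + bs' i) t) (sub-ground {ts i} g ρ) o)
      ... | inj₁ (x , tᵢ≡x) = begin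
        lhsArg (n + k) i ⟪ η′ ⟫                                 ≡⟨ cpowApp-sub Cᵢ Cᵢ-free A (ts i) η′ ⟩
        cpowApp Cᵢ A (ts i ⟪ η′ ⟫)                              ≡⟨ cong (cpowApp Cᵢ A) (trans (cong (_⟪ η′ ⟫) tᵢ≡x) (η′-at i x tᵢ≡x)) ⟩
        cpowApp Cᵢ A (cpowApp Cᵢ gap (app ρ x ⟪ η ⟫))           ≡⟨ cpowApp-+ Cᵢ A gap (app ρ x ⟪ η ⟫) ⟩
        cpowApp Cᵢ (A + gap) (app ρ x ⟪ η ⟫)                    ≡⟨ cong (λ e → cpowApp Cᵢ e (app ρ x ⟪ η ⟫)) A+gap≡ ⟩
        cpowApp Cᵢ (as' i * n + bs' i) (app ρ x ⟪ η ⟫)          ≡⟨ cong (λ t → cpowApp Cᵢ (as' i * n + bs' i) (t ⟪ ρ ⟫ ⟪ η ⟫)) tᵢ≡x ⟨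
        cpowApp Cᵢ (as' i * n + bs' i) (ts i ⟪ ρ ⟫ ⟪ η ⟫)       ≡⟨ cpowApp-sub Cᵢ Cᵢ-free (as' i * n + bs' i) (ts i ⟪ ρ ⟫) η ⟨
        rhsArg n i ⟪ η ⟫                                        ∎
        where
          open ≡-Reasoning
          Cᵢ = ctx (cs i)
          Cᵢ-free = noVar (cs i)
          A = as i * (n + k) + bs i
          A≡ : A ≡ a * (n + k) + d
          A≡ = cong₂ (λ a″ d″ → a″ * (n + k) + d″) (proj₁ (vA i (x , tᵢ≡x))) (proj₁ (vB i (x , tᵢ≡x)))
          A+gap≡ : A + gap ≡ as' i * n + bs' i
          A+gap≡ = begin
            A + gap                                       ≡⟨ cong (_+ gap) A≡ ⟩
            a * (n + k) + d + (a' * n + d' ∸ (a * (n + k) + d)) ≡⟨ m+[n∸m]≡n fits ⟩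
            a' * n + d'                                   ≡⟨ cong₂ (λ a″ d″ → a″ * n + d″) (proj₂ (vA i (x , tᵢ≡x))) (proj₂ (vB i (x , tᵢ≡x))) ⟨
            as' i * n + bs' i                             ∎

    lhs-shift : ∀ n → alpha W ℚ.≤ ℕtoℚ n → ∀ η → Σ Subst λ η′ → lhsAt (n + k) ⟪ η′ ⟫ ≡ rhsAt n ⟪ η ⟫
    lhs-shift n α≤n η = η′ , (begin
      lhsAt (n + k) ⟪ η′ ⟫                                 ≡⟨ plug-tabulate-sub c cNoVar (lhsArg (n + k)) η′ ⟩
      plug c (tabulate (λ i → lhsArg (n + k) i ⟪ η′ ⟫))    ≡⟨ cong (plug c) (VecP.tabulate-cong (arg-shift fits)) ⟩
      plug c (tabulate (λ i → rhsArg n i ⟪ η ⟫))           ≡⟨ plug-tabulate-sub c cNoVar (rhsArg n) η ⟨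
      rhsAt n ⟪ η ⟫                                        ∎)
      where
        open ≡-Reasoning
        open Shift n η
        fits : a * (n + k) + d ≤ a' * n + d'
        fits = shift-fits a a' k d d' n a≤a' cond5 (alphaQ≤n⇒cleared a a' _ n α≤n)

open import Data.Rational using (_≤_)

propositionA9 : (Sg : Signature) → let open WithSig Sg in
    (P : Program) (B : Pred PatRule 0ℓ) → Correct P B →
    (r : PatRule) → patunf P B r → (W : Special r) →
    (n : ℕ) → alpha W ≤ ℕtoℚ n → (θ : Subst) →
    Σ Subst λ η →
      CallsE P (inst (proj₁ r) n ⟪ θ ⟫ₑ) (inst (proj₁ r) (n + Special.k W) ⟪ η ⟫ₑ)
propositionA9 Sg P B B-correct r r∈patunf W n α≤n θ =
  η′ , subst₂ (λ s s′ → CallsE P (s ⟪ θ ⟫ₑ) (s′ ⟪ η′ ⟫ₑ)) (sym (lhs-inst n)) (sym (lhs-inst (n + Special.k W)))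
              (subst (Calls P (lhsAt n ⟪ θ ⟫)) (cong just (sym lhs-shifted)) call)
  where
    open WithSig Sg
    open SpecialRule Sg W
    nth-instance : binunf P (just (lhsAt n) , just (rhsAt n))
    nth-instance = subst (binunf P) (cong₂ _,_ (lhs-inst n) (rhs-inst n)) (patunf-correct Sg P B B-correct r r∈patunf n)
    η = proj₁ (binunf-calls Sg P nth-instance (rhs-not-flat n) θ refl)
    call = proj₂ (binunf-calls Sg P nth-instance (rhs-not-flat n) θ refl)
    η′ = proj₁ (lhs-shift n α≤n η)
    lhs-shifted = proj₂ (lhs-shift n α≤n η)
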